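{- Let $n\geq 4$ and let $B=\operatorname{circ}(3,-1,0,\ldots,0,-1)$ of order $n-1$. Let \[L=\left[\begin{array}{c|c} n-1 & -\mathbf{1}^T \\ \hline -\mathbf{1} & B \end{array}\right]\] (the Laplacian matrix of the wheel graph $W_n$, with the hub as the first vertex). Let $C=\operatorname{circ}(1,0,\ldots,0,-1)$ of order $n-1$. Then the Moore–Penrose inverse of $L$ is \[L^+=\frac{1}{n^2}\left[\begin{array}{c|c} n-1 & -\mathbf{1}^T \\ \hline -\mathbf{1} & -J_{n-1}-nX \end{array}\right],\] where $X=(CC^T+I_{n-1})^{ -1}\left[J_{n-1}-nI_{n-1}\right]=\operatorname{circ}(b_0,b_1,\ldots,b_{n-2})$ with, for $j=0,\ldots,n-2$, \[b_j=1+\frac{n2^{n-1-j}}{\sqrt{5}}\left[\frac{(3+\sqrt{5})^j}{2^{n-1}-(3+\sqrt{5})^{n-1}}-\frac{(3-\sqrt{5})^j}{2^{n-1}-(3-\sqrt{5})^{n-1}}\right].\]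
   Context: For real numbers $c_0,\ldots,c_{k-1}$, $\operatorname{circ}(c_0,c_1,\ldots,c_{k-1})$ denotes the $k\times k$ circulant matrix whose $(i,j)$-entry is $c_{(j-i)\bmod k}$. $\mathbf{1}$ is the all-ones column vector of length $n-1$, $I_k$ the $k\times k$ identity and $J_k$ the $k\times k$ all-ones matrix. The wheel graph $W_n$ is obtained from a cycle on $n-1$ vertices by adding a vertex adjacent to all of them; its Laplacian is $D-A$ (degree matrix minus adjacency matrix). The Moore–Penrose inverse of a real matrix $A$ is the unique matrix $A^+$ with $AA^+A=A$, $A^+AA^+=A^+$, $(AA^+)^T=AA^+$, $(A^+A)^T=A^+A$. -}

module Defs where

open import Data.Nat as ℕ using (ℕ; zero; suc; _%_; _∸_)
open import Data.Fin using (Fin; toℕ) renaming (zero to fzero; suc to fsuc)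
open import Data.Integer using (+_)
open import Data.Rational as Q using (ℚ; 0ℚ; 1ℚ; 1/_; ≢-nonZero)
open import Data.Rational.Properties using () renaming (_≟_ to _≟Q_)
open import Data.Product using (_×_)
open import Relation.Nullary using (yes; no)
open import Relation.Binary.PropositionalEquality using (_≡_)

-- The real quadratic field ℚ(√5) ⊂ ℝ, elements re + im·√5.
-- Since √5 is irrational, the representation is unique, so ≡ on
-- records (with normalised rationals) is equality of real numbers.

record K : Set where
  constructor _+√5·_
  field
    re : ℚ
    im : ℚ

open K public

ofℚ : ℚ → K
ofℚ q = q +√5· 0ℚ

ofℕ : ℕ → K
ofℕ k = ofℚ (+ k Q./ 1)

0K 1K √5 : K
0K = ofℚ 0ℚ
1K = ofℚ 1ℚ
√5 = 0ℚ +√5· 1ℚ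

infixl 6 _+K_ _-K_
infixl 7 _*K_
infix 8 -K_

_+K_ : K → K → K
(a +√5· b) +K (c +√5· d) = (a Q.+ c) +√5· (b Q.+ d)

-K_ : K → K
-K (a +√5· b) = (Q.- a) +√5· (Q.- b)

_-K_ : K → K → K
x -K y = x +K (-K y)

_*K_ : K → K → K
(a +√5· b) *K (c +√5· d) =
  (a Q.* c Q.+ (+ 5 Q./ 1) Q.* (b Q.* d)) +√5· (a Q.* d Q.+ b Q.* c)

_^K_ : K → ℕ → K
x ^K zero  = 1K
x ^K suc k = x *K (x ^K k)

-- total reciprocal on ℚ (junk value 0 at 0)
recipℚ : ℚ → ℚ
recipℚ p with p ≟Q 0ℚ
... | yes _  = 0ℚ
... | no p≢0 = 1/_ p {{≢-nonZero p≢0}}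

-- multiplicative inverse in ℚ(√5): (a + b√5)⁻¹ = (a - b√5)/(a² - 5b²);
-- a² - 5b² ≠ 0 for every nonzero element. Junk value 0 at 0.
invK : K → K
invK (a +√5· b) =
  let N = recipℚ (a Q.* a Q.- (+ 5 Q./ 1) Q.* (b Q.* b))
  in (a Q.* N) +√5· (Q.- b Q.* N)

_/K_ : K → K → K
x /K y = x *K invK y

Mat : ℕ → Set
Mat k = Fin k → Fin k → K

sumK : (k : ℕ) → (Fin k → K) → K
sumK zero    f = 0K
sumK (suc k) f = f fzero +K sumK k (λ i → f (fsuc i))

_⊗_ : {k : ℕ} → Mat k → Mat k → Mat k
_⊗_ {k} A B i j = sumK k (λ l → A i l *K B l j)

infixl 7 _⊗_
infixl 6 _⊕_ _⊖_
infixr 8 _·M_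
infix 9 _ᵀ

_ᵀ : {k : ℕ} → Mat k → Mat k
(A ᵀ) i j = A j i

_≈M_ : {k : ℕ} → Mat k → Mat k → Set
A ≈M B = ∀ i j → A i j ≡ B i j

infix 4 _≈M_

_⊕_ : {k : ℕ} → Mat k → Mat k → Mat k
(A ⊕ B) i j = A i j +K B i j

_⊖_ : {k : ℕ} → Mat k → Mat k → Mat k
(A ⊖ B) i j = A i j -K B i j

_·M_ : {k : ℕ} → K → Mat k → Mat k
(c ·M A) i j = c *K A i j

Id : (k : ℕ) → Mat k
Id k i j with toℕ i ℕ.≟ toℕ j
... | yes _ = 1K
... | no  _ = 0K

Jm : (k : ℕ) → Mat k
Jm k i j = 1K

-- circ(c_0,…,c_{k-1}) : (i,j)-entry is c_{(j-i) mod k}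
circ : (k : ℕ) → (ℕ → K) → Mat k
circ zero    c ()
circ (suc k) c i j = c ((suc k ℕ.+ toℕ j ∸ toℕ i) % suc k)

-- block matrix [ a | rowᵀ ; col | M ], first index = the hub
block : {k : ℕ} → K → (Fin k → K) → (Fin k → K) → Mat k → Mat (suc k)
block a r c M fzero    fzero    = a
block a r c M fzero    (fsuc j) = r j
block a r c M (fsuc i) fzero    = c i
block a r c M (fsuc i) (fsuc j) = M i j

IsMoorePenroseInverse : {k : ℕ} → Mat k → Mat k → Set
IsMoorePenroseInverse A G =
  (A ⊗ G ⊗ A ≈M A) × (G ⊗ A ⊗ G ≈M G) ×
  ((A ⊗ G) ᵀ ≈M A ⊗ G) × ((G ⊗ A) ᵀ ≈M G ⊗ A)

IsInverse : {k : ℕ} → Mat k → Mat k → Set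
IsInverse A Ainv = (A ⊗ Ainv ≈M Id _) × (Ainv ⊗ A ≈M Id _)

-- The data of the theorem, with m = n - 1 (so n = suc m).

Bcoef : ℕ → ℕ → K
Bcoef m j with j ℕ.≟ 0
... | yes _ = ofℕ 3
... | no _ with j ℕ.≟ 1
...   | yes _ = -K 1K
...   | no _ with j ℕ.≟ (m ∸ 1)
...     | yes _ = -K 1K
...     | no _  = 0K

Ccoef : ℕ → ℕ → K
Ccoef m j with j ℕ.≟ 0
... | yes _ = 1K
... | no _ with j ℕ.≟ (m ∸ 1)
...   | yes _ = -K 1K
...   | no _  = 0K

Bm : (m : ℕ) → Mat m
Bm m = circ m (Bcoef m)

Cm : (m : ℕ) → Mat m
Cm m = circ m (Ccoef m)

ones : (m : ℕ) → Fin m → K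
ones m _ = 1K

Lw : (m : ℕ) → Mat (suc m)
Lw m = block (ofℕ m) (λ i → -K ones m i) (λ i → -K ones m i) (Bm m)

bcoef : ℕ → ℕ → K
bcoef m j =
  let n  = ofℕ (suc m)
      two = ofℕ 2
      φ₊ = ofℕ 3 +K √5
      φ₋ = ofℕ 3 -K √5
  in 1K +K ((n *K (two ^K (m ∸ j))) /K √5) *K
            ((φ₊ ^K j) /K ((two ^K m) -K (φ₊ ^K m))
             -K (φ₋ ^K j) /K ((two ^K m) -K (φ₋ ^K m)))

Xm : (m : ℕ) → Mat m
Xm m = circ m (bcoef m)

Lplus : (m : ℕ) → Mat (suc m)
Lplus m =
  let n = ofℕ (suc m) in
  invK (n *K n) ·M
    block (ofℕ m) (λ i → -K ones m i) (λ i → -K ones m i)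
          ((-K 1K) ·M Jm m ⊖ n ·M Xm m)

{-# OPTIONS --safe #-}
-- All entries lie in the real quadratic field ℚ(√5). The block B = CCᵀ + I is the circulant
-- 3I - P - P⁻¹ (P the cyclic shift), and the b_j are built from the roots (3 ± √5)/2 of
-- t² - 3t + 1 so that 3b_k - b_{k-1} - b_{k+1} = 1 - n[k = 0] cyclically; at the wrap-around
-- this is forced by the denominators 2^{n-1} - (3 ± √5)^{n-1}, which are nonzero because their
-- norm -2^n (re (3 + √5)^{n-1} - 2^{n-1}) is negative. Hence BX = XB = J - nI. As B has unit
-- row and column sums, (J - X)/n inverts B, and for the bordered matrix H of -J - nX one gets
-- LH = HL = n²I - nJ and JL = JH = 0, which makes H/n² the Moore–Penrose inverse of L.
module Submission where

open import Defs
open import Data.Nat as ℕ using (ℕ; zero; suc; _≤_; _<_; z≤n; s≤s)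
open import Data.Product using (_×_; Σ; _,_)
open import Data.Integer using (+_)
open import Data.Rational as Q using (ℚ; 0ℚ; 1ℚ; Positive; NonNegative; Negative)
import Data.Rational.Properties as ℚP
open import Relation.Binary.PropositionalEquality
open import Function using (_∘_)
open import Relation.Nullary using (Dec; yes; no; contradiction)
open import Relation.Nullary.Decidable using (dec⇒maybe)
open import Algebra.Bundles using (CommutativeRing)
open import Algebra.Structures {A = K} _≡_ using (IsCommutativeRing)
open import Data.Fin using (Fin; toℕ) renaming (zero to fzero; suc to fsuc)
open import Data.Fin.Properties using (toℕ-injective)
open import Data.Rational.Unnormalised as Qᵘ using (mkℚᵘ)
import Data.Rational.Unnormalised.Properties as ℚᵘP
open import Relation.Binary.Bundles using (Setoid)
import Relation.Binary.Reasoning.Setoid as SetoidReasoning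
open import Tactic.RingSolver using (solve-∀)
open import Tactic.RingSolver.Core.AlmostCommutativeRing
  using (AlmostCommutativeRing; fromCommutativeRing)

-- ℚ(√5) as a commutative ring

ℚ-solverRing : AlmostCommutativeRing _ _
ℚ-solverRing = fromCommutativeRing ℚP.+-*-commutativeRing (λ x → dec⇒maybe (0ℚ ℚP.≟ x))

five : ℚ
five = + 5 Q./ 1

√5-cong : ∀ {a b c d} → a ≡ c → b ≡ d → a +√5· b ≡ c +√5· d
√5-cong = cong₂ _+√5·_

+K-assoc : ∀ x y z → (x +K y) +K z ≡ x +K (y +K z)
+K-assoc (a +√5· b) (c +√5· d) (e +√5· f) = √5-cong (ℚP.+-assoc a c e) (ℚP.+-assoc b d f)

+K-comm : ∀ x y → x +K y ≡ y +K x
+K-comm (a +√5· b) (c +√5· d) = √5-cong (ℚP.+-comm a c) (ℚP.+-comm b d)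

+K-identityˡ : ∀ x → 0K +K x ≡ x
+K-identityˡ (a +√5· b) = √5-cong (ℚP.+-identityˡ a) (ℚP.+-identityˡ b)

+K-identityʳ : ∀ x → x +K 0K ≡ x
+K-identityʳ (a +√5· b) = √5-cong (ℚP.+-identityʳ a) (ℚP.+-identityʳ b)

+K-inverseˡ : ∀ x → (-K x) +K x ≡ 0K
+K-inverseˡ (a +√5· b) = √5-cong (ℚP.+-inverseˡ a) (ℚP.+-inverseˡ b)

+K-inverseʳ : ∀ x → x +K (-K x) ≡ 0K
+K-inverseʳ (a +√5· b) = √5-cong (ℚP.+-inverseʳ a) (ℚP.+-inverseʳ b)

module _ where
  open Q using (_+_; _*_)

  *K-comm : ∀ x y → x *K y ≡ y *K x
  *K-comm (a +√5· b) (c +√5· d) = √5-cong (re-comm a b c d five) (im-comm a b c d)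
    where
    re-comm : ∀ a b c d f → a * c + f * (b * d) ≡ c * a + f * (d * b)
    re-comm = solve-∀ ℚ-solverRing
    im-comm : ∀ a b c d → a * d + b * c ≡ c * b + d * a
    im-comm = solve-∀ ℚ-solverRing

  *K-assoc : ∀ x y z → (x *K y) *K z ≡ x *K (y *K z)
  *K-assoc (a +√5· b) (c +√5· d) (e +√5· g) =
    √5-cong (re-assoc a b c d e g five) (im-assoc a b c d e g five)
    where
    re-assoc : ∀ a b c d e g f → (a * c + f * (b * d)) * e + f * ((a * d + b * c) * g)
                                 ≡ a * (c * e + f * (d * g)) + f * (b * (c * g + d * e))
    re-assoc = solve-∀ ℚ-solverRing
    im-assoc : ∀ a b c d e g f → (a * c + f * (b * d)) * g + (a * d + b * c) * e
                                 ≡ a * (c * g + d * e) + b * (c * e + f * (d * g))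
    im-assoc = solve-∀ ℚ-solverRing

  *K-identityˡ : ∀ x → 1K *K x ≡ x
  *K-identityˡ (a +√5· b) = √5-cong (re-id a b five) (im-id a b)
    where
    re-id : ∀ a b f → 1ℚ * a + f * (0ℚ * b) ≡ a
    re-id = solve-∀ ℚ-solverRing
    im-id : ∀ a b → 1ℚ * b + 0ℚ * a ≡ b
    im-id = solve-∀ ℚ-solverRing

  *K-distribˡ : ∀ x y z → x *K (y +K z) ≡ x *K y +K x *K z
  *K-distribˡ (a +√5· b) (c +√5· d) (e +√5· g) =
    √5-cong (re-distrib a b c d e g five) (im-distrib a b c d e g)
    where
    re-distrib : ∀ a b c d e g f → a * (c + e) + f * (b * (d + g))
                                   ≡ (a * c + f * (b * d)) + (a * e + f * (b * g))
    re-distrib = solve-∀ ℚ-solverRing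
    im-distrib : ∀ a b c d e g → a * (d + g) + b * (c + e) ≡ (a * d + b * c) + (a * g + b * e)
    im-distrib = solve-∀ ℚ-solverRing

*K-identityʳ : ∀ x → x *K 1K ≡ x
*K-identityʳ x = trans (*K-comm x 1K) (*K-identityˡ x)

*K-distribʳ : ∀ x y z → (y +K z) *K x ≡ y *K x +K z *K x
*K-distribʳ x y z =
  trans (*K-comm (y +K z) x) (trans (*K-distribˡ x y z) (cong₂ _+K_ (*K-comm x y) (*K-comm x z)))

K-isCommutativeRing : IsCommutativeRing _+K_ _*K_ -K_ 0K 1K
K-isCommutativeRing = record
  { isRing = record
    { +-isAbelianGroup = record
      { isGroup = record
        { isMonoid = record
          { isSemigroup = record
            { isMagma = record { isEquivalence = isEquivalence ; ∙-cong = cong₂ _+K_ }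
            ; assoc = +K-assoc }
          ; identity = +K-identityˡ , +K-identityʳ }
        ; inverse = +K-inverseˡ , +K-inverseʳ
        ; ⁻¹-cong = cong (λ x → -K x) }
      ; comm = +K-comm }
    ; *-cong = cong₂ _*K_
    ; *-assoc = *K-assoc
    ; *-identity = *K-identityˡ , *K-identityʳ
    ; distrib = *K-distribˡ , *K-distribʳ }
  ; *-comm = *K-comm }

K-commutativeRing : CommutativeRing _ _
K-commutativeRing = record { isCommutativeRing = K-isCommutativeRing }

_≟K_ : (x y : K) → Dec (x ≡ y)
(a +√5· b) ≟K (c +√5· d) with a ℚP.≟ c | b ℚP.≟ d
... | yes refl | yes refl = yes refl
... | no a≢c   | _        = no (λ e → a≢c (cong re e))
... | yes _    | no b≢d   = no (λ e → b≢d (cong im e))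

K-solverRing : AlmostCommutativeRing _ _
K-solverRing = fromCommutativeRing K-commutativeRing (λ x → dec⇒maybe (0K ≟K x))

module _ where
  open Q using (_+_; _*_; _-_; -_)

  norm : K → ℚ
  norm x = re x * re x - five * (im x * im x)

  conj : K → K
  conj x = re x +√5· (- im x)

  norm-*K : ∀ x y → norm (x *K y) ≡ norm x * norm y
  norm-*K (a +√5· b) (c +√5· d) = multiplicative a b c d five
    where
    multiplicative : ∀ a b c d f →
      (a * c + f * (b * d)) * (a * c + f * (b * d)) - f * ((a * d + b * c) * (a * d + b * c))
      ≡ (a * a - f * (b * b)) * (c * c - f * (d * d))
    multiplicative = solve-∀ ℚ-solverRing

  norm-conj : ∀ x → norm (conj x) ≡ norm x
  norm-conj x = even (re x) (im x) five
    where
    even : ∀ a b f → a * a - f * (- b * - b) ≡ a * a - f * (b * b)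
    even = solve-∀ ℚ-solverRing

  conj-*K : ∀ x y → conj (x *K y) ≡ conj x *K conj y
  conj-*K (a +√5· b) (c +√5· d) = √5-cong (re-conj a b c d five) (im-conj a b c d)
    where
    re-conj : ∀ a b c d f → a * c + f * (b * d) ≡ a * c + f * (- b * - d)
    re-conj = solve-∀ ℚ-solverRing
    im-conj : ∀ a b c d → - (a * d + b * c) ≡ a * - d + - b * c
    im-conj = solve-∀ ℚ-solverRing

  recipℚ-inverseˡ : ∀ p → p ≢ 0ℚ → recipℚ p * p ≡ 1ℚ
  recipℚ-inverseˡ p p≢0 with p ℚP.≟ 0ℚ
  ... | yes p≡0 = contradiction p≡0 p≢0
  ... | no p≢0′ = ℚP.*-inverseˡ p {{Q.≢-nonZero p≢0′}}

  invK-inverseˡ : ∀ x → norm x ≢ 0ℚ → invK x *K x ≡ 1K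
  invK-inverseˡ (a +√5· b) N≢0 =
    √5-cong (trans (re-inv a b N⁻¹ five) (recipℚ-inverseˡ N N≢0)) (im-inv a b N⁻¹)
    where
    N = a * a - five * (b * b)
    N⁻¹ = recipℚ N
    re-inv : ∀ a b r f → (a * r) * a + f * ((- b * r) * b) ≡ r * (a * a - f * (b * b))
    re-inv = solve-∀ ℚ-solverRing
    im-inv : ∀ a b r → (a * r) * b + (- b * r) * a ≡ 0ℚ
    im-inv = solve-∀ ℚ-solverRing

  norm-sub : ∀ x y → im x ≡ 0ℚ → norm y ≡ norm x →
             norm (x -K y) ≡ - ((re x + re x) * (re y - re x))
  norm-sub (c +√5· _) (a +√5· b) refl Ny≡Nx = begin
    norm ((c +√5· 0ℚ) -K (a +√5· b))
      ≡⟨ expand a b c five ⟩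
    - ((c + c) * (a - c)) + (norm (a +√5· b) - norm (c +√5· 0ℚ))
      ≡⟨ cong (λ t → - ((c + c) * (a - c)) + (t - norm (c +√5· 0ℚ))) Ny≡Nx ⟩
    - ((c + c) * (a - c)) + (norm (c +√5· 0ℚ) - norm (c +√5· 0ℚ))
      ≡⟨ cancel (- ((c + c) * (a - c))) (norm (c +√5· 0ℚ)) ⟩
    - ((c + c) * (a - c)) ∎
    where
    open ≡-Reasoning
    expand : ∀ a b c f →
      (c + - a) * (c + - a) - f * ((0ℚ + - b) * (0ℚ + - b))
      ≡ - ((c + c) * (a - c)) + ((a * a - f * (b * b)) - (c * c - f * (0ℚ * 0ℚ)))
    expand = solve-∀ ℚ-solverRing
    cancel : ∀ p q → p + (q - q) ≡ p
    cancel = solve-∀ ℚ-solverRing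

  invK-sub-inverseˡ : ∀ x y → im x ≡ 0ℚ → norm y ≡ norm x →
                      Positive (re x) → Positive (re y - re x) →
                      invK (x -K y) *K (x -K y) ≡ 1K
  invK-sub-inverseˡ x y im≡0 Ny≡Nx c>0 a>c = invK-inverseˡ (x -K y) N≢0
    where
    N<0 : Negative (- ((re x + re x) * (re y - re x)))
    N<0 = ℚP.neg-pos {(re x + re x) * (re y - re x)}
            (ℚP.pos*pos⇒pos (re x + re x) {{ℚP.pos+pos⇒pos (re x) {{c>0}} (re x) {{c>0}}}} (re y - re x) {{a>c}})
    N≢0 : norm (x -K y) ≢ 0ℚ
    N≢0 N≡0 = ℚP.<-irrefl (trans (sym (norm-sub x y im≡0 Ny≡Nx)) N≡0)
                           (ℚP.negative⁻¹ _ {{N<0}})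

-- ℚ normalises sums, so the additivity of ℕ → ℚ is checked in ℚᵘ
ofℕ-suc : ∀ k → ofℕ (suc k) ≡ ofℕ k +K 1K
ofℕ-suc k = √5-cong (ℚP.toℚᵘ-injective (begin
  Q.toℚᵘ (+ suc k Q./ 1)                  ≈⟨ ℚP.toℚᵘ-fromℚᵘ (mkℚᵘ (+ suc k) 0) ⟩
  mkℚᵘ (+ suc k) 0                        ≈⟨ k+1≃1+k ⟨
  mkℚᵘ (+ k) 0 Qᵘ.+ Qᵘ.1ℚᵘ                ≈⟨ ℚᵘP.+-congˡ Qᵘ.1ℚᵘ (ℚP.toℚᵘ-fromℚᵘ (mkℚᵘ (+ k) 0)) ⟨
  Q.toℚᵘ (+ k Q./ 1) Qᵘ.+ Q.toℚᵘ 1ℚ       ≈⟨ ℚP.toℚᵘ-homo-+ (+ k Q./ 1) 1ℚ ⟨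
  Q.toℚᵘ (+ k Q./ 1 Q.+ 1ℚ)               ∎)) refl
  where
  open ℚᵘP.≃-Reasoning
  open import Data.Integer.Tactic.RingSolver using () renaming (solve-∀ to solve-ℤ)
  open import Data.Integer as ℤ using ()
  import Data.Integer.Properties as ℤP
  k+1≃1+k : mkℚᵘ (+ k) 0 Qᵘ.+ Qᵘ.1ℚᵘ Qᵘ.≃ mkℚᵘ (+ suc k) 0
  k+1≃1+k = Qᵘ.*≡* (trans (normalise (+ k)) (sym (cong (ℤ._* (+ 1 ℤ.* + 1)) (ℤP.pos-+ 1 k))))
    where
    normalise : ∀ x → (x ℤ.* + 1 ℤ.+ + 1 ℤ.* + 1) ℤ.* + 1 ≡ (+ 1 ℤ.+ x) ℤ.* (+ 1 ℤ.* + 1)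
    normalise = solve-ℤ

norm-ofℚ : ∀ q → norm (ofℚ q) ≡ q Q.* q
norm-ofℚ q = vanish q five
  where
  open Q using (_*_; _-_)
  vanish : ∀ q f → q * q - f * (0ℚ * 0ℚ) ≡ q * q
  vanish = solve-∀ ℚ-solverRing

invK-inverseˡ-pos : ∀ x → Positive (norm x) → invK x *K x ≡ 1K
invK-inverseˡ-pos x N>0 = invK-inverseˡ x (λ N≡0 → ℚP.<-irrefl (sym N≡0) (ℚP.positive⁻¹ _ {{N>0}}))

norm-ofℕ-suc-pos : ∀ k → Positive (norm (ofℕ (suc k)))
norm-ofℕ-suc-pos k = subst Positive (sym (norm-ofℚ q)) (ℚP.pos*pos⇒pos q {{q>0}} q {{q>0}})
  where
  q = + suc k Q./ 1
  q>0 = ℚP.normalize-pos (suc k) 1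

invK-ofℕ-suc : ∀ k → invK (ofℕ (suc k)) *K ofℕ (suc k) ≡ 1K
invK-ofℕ-suc k = invK-inverseˡ-pos (ofℕ (suc k)) (norm-ofℕ-suc-pos k)

invK-ofℕ-suc² : ∀ k → invK (ofℕ (suc k) *K ofℕ (suc k)) *K (ofℕ (suc k) *K ofℕ (suc k)) ≡ 1K
invK-ofℕ-suc² k = invK-inverseˡ-pos (n *K n)
  (subst Positive (sym (norm-*K n n)) (ℚP.pos*pos⇒pos (norm n) {{N>0}} (norm n) {{N>0}}))
  where
  n = ofℕ (suc k)
  N>0 = norm-ofℕ-suc-pos k

open import Algebra.Properties.Semiring.Sum (CommutativeRing.semiring K-commutativeRing)
  using (sum; ∑-distrib-+; ∑-comm; *-distribˡ-sum; *-distribʳ-sum)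

sumK≡sum : ∀ k (f : Fin k → K) → sumK k f ≡ sum f
sumK≡sum zero    f = refl
sumK≡sum (suc k) f = cong (f fzero +K_) (sumK≡sum k (λ i → f (fsuc i)))

sumK-cong : ∀ k {f g : Fin k → K} → (∀ i → f i ≡ g i) → sumK k f ≡ sumK k g
sumK-cong zero    f≗g = refl
sumK-cong (suc k) f≗g = cong₂ _+K_ (f≗g fzero) (sumK-cong k (λ i → f≗g (fsuc i)))

sumK-distrib-+K : ∀ k (f g : Fin k → K) → sumK k (λ i → f i +K g i) ≡ sumK k f +K sumK k g
sumK-distrib-+K k f g = begin
  sumK k (λ i → f i +K g i) ≡⟨ sumK≡sum k _ ⟩
  sum (λ i → f i +K g i)    ≡⟨ ∑-distrib-+ f g ⟩
  sum f +K sum g            ≡⟨ cong₂ _+K_ (sumK≡sum k f) (sumK≡sum k g) ⟨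
  sumK k f +K sumK k g      ∎
  where open ≡-Reasoning

sumK-*ˡ : ∀ k c (f : Fin k → K) → sumK k (λ i → c *K f i) ≡ c *K sumK k f
sumK-*ˡ k c f = begin
  sumK k (λ i → c *K f i) ≡⟨ sumK≡sum k _ ⟩
  sum (λ i → c *K f i)    ≡⟨ *-distribˡ-sum c f ⟨
  c *K sum f              ≡⟨ cong (c *K_) (sumK≡sum k f) ⟨
  c *K sumK k f           ∎
  where open ≡-Reasoning

sumK-*ʳ : ∀ k c (f : Fin k → K) → sumK k (λ i → f i *K c) ≡ sumK k f *K c
sumK-*ʳ k c f = begin
  sumK k (λ i → f i *K c) ≡⟨ sumK≡sum k _ ⟩
  sum (λ i → f i *K c)    ≡⟨ *-distribʳ-sum c f ⟨
  sum f *K c              ≡⟨ cong (_*K c) (sumK≡sum k f) ⟨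
  sumK k f *K c           ∎
  where open ≡-Reasoning

sumK-comm : ∀ k l (f : Fin k → Fin l → K) →
            sumK k (λ i → sumK l (f i)) ≡ sumK l (λ j → sumK k (λ i → f i j))
sumK-comm k l f = begin
  sumK k (λ i → sumK l (f i))             ≡⟨ sumK-cong k (λ i → sumK≡sum l (f i)) ⟩
  sumK k (λ i → sum (f i))                ≡⟨ sumK≡sum k _ ⟩
  sum (λ i → sum (f i))                   ≡⟨ ∑-comm f ⟩
  sum (λ j → sum (λ i → f i j))           ≡⟨ sumK≡sum l _ ⟨
  sumK l (λ j → sum (λ i → f i j))        ≡⟨ sumK-cong l (λ j → sumK≡sum k (λ i → f i j)) ⟨
  sumK l (λ j → sumK k (λ i → f i j))     ∎
  where open ≡-Reasoning

sumK-distrib-−K : ∀ k (f g : Fin k → K) → sumK k (λ i → f i -K g i) ≡ sumK k f -K sumK k g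
sumK-distrib-−K k f g = begin
  sumK k (λ i → f i -K g i)                       ≡⟨ sumK-cong k (λ i → cong (f i +K_) (neg (g i))) ⟩
  sumK k (λ i → f i +K (-K 1K) *K g i)            ≡⟨ sumK-distrib-+K k f _ ⟩
  sumK k f +K sumK k (λ i → (-K 1K) *K g i)       ≡⟨ cong (sumK k f +K_) (sumK-*ˡ k (-K 1K) g) ⟩
  sumK k f +K (-K 1K) *K sumK k g                 ≡⟨ cong (sumK k f +K_) (neg (sumK k g)) ⟨
  sumK k f -K sumK k g                            ∎
  where
  open ≡-Reasoning
  neg : ∀ x → -K x ≡ (-K 1K) *K x
  neg = solve-∀ K-solverRing

sumK-const : ∀ k c → sumK k (λ _ → c) ≡ c *K ofℕ k
sumK-const zero    c = annihilate c
  where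
  annihilate : ∀ c → 0K ≡ c *K 0K
  annihilate = solve-∀ K-solverRing
sumK-const (suc k) c = begin
  c +K sumK k (λ _ → c)   ≡⟨ cong (c +K_) (sumK-const k c) ⟩
  c +K c *K ofℕ k         ≡⟨ regroup c (ofℕ k) ⟩
  c *K (ofℕ k +K 1K)      ≡⟨ cong (c *K_) (ofℕ-suc k) ⟨
  c *K ofℕ (suc k)        ∎
  where
  open ≡-Reasoning
  regroup : ∀ c a → c +K c *K a ≡ c *K (a +K 1K)
  regroup = solve-∀ K-solverRing

δ : ℕ → ℕ → K
δ x y with x ℕ.≟ y
... | yes _ = 1K
... | no  _ = 0K

δ-cong-⇔ : ∀ {x y a b} → (x ≡ y → a ≡ b) → (a ≡ b → x ≡ y) → δ x y ≡ δ a b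
δ-cong-⇔ {x} {y} {a} {b} to from with x ℕ.≟ y | a ℕ.≟ b
... | yes _   | yes _   = refl
... | yes x≡y | no  a≢b = contradiction (to x≡y) a≢b
... | no  x≢y | yes a≡b = contradiction (from a≡b) x≢y
... | no  _   | no  _   = refl

Id-δ : ∀ k (i j : Fin k) → Id k i j ≡ δ (toℕ i) (toℕ j)
Id-δ k i j with toℕ i ℕ.≟ toℕ j
... | yes _ = refl
... | no  _ = refl

Id-cong-⇔ : ∀ {k} {i j a b : Fin k} → (i ≡ j → a ≡ b) → (a ≡ b → i ≡ j) → Id k i j ≡ Id k a b
Id-cong-⇔ {k} {i} {j} {a} {b} to from = begin
  Id k i j                ≡⟨ Id-δ k i j ⟩
  δ (toℕ i) (toℕ j)       ≡⟨ δ-cong-⇔ (cong toℕ ∘ to ∘ toℕ-injective) (cong toℕ ∘ from ∘ toℕ-injective) ⟩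
  δ (toℕ a) (toℕ b)       ≡⟨ Id-δ k a b ⟨
  Id k a b                ∎
  where open ≡-Reasoning

Id-sym : ∀ k (i j : Fin k) → Id k i j ≡ Id k j i
Id-sym k i j = Id-cong-⇔ sym sym

Id-suc : ∀ k (i j : Fin k) → Id (suc k) (fsuc i) (fsuc j) ≡ Id k i j
Id-suc k i j = trans (Id-δ (suc k) (fsuc i) (fsuc j))
  (trans (δ-cong-⇔ (cong ℕ.pred) (cong suc)) (sym (Id-δ k i j)))

sumK-Idˡ : ∀ k (i : Fin k) (f : Fin k → K) → sumK k (λ l → Id k i l *K f l) ≡ f i
sumK-Idˡ (suc k) fzero f = begin
  1K *K f fzero +K sumK k (λ l → 0K *K f (fsuc l))   ≡⟨ cong (1K *K f fzero +K_) (sumK-*ˡ k 0K _) ⟩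
  1K *K f fzero +K 0K *K sumK k (λ l → f (fsuc l))   ≡⟨ unit (f fzero) (sumK k (λ l → f (fsuc l))) ⟩
  f fzero                                             ∎
  where
  open ≡-Reasoning
  unit : ∀ x s → 1K *K x +K 0K *K s ≡ x
  unit = solve-∀ K-solverRing
sumK-Idˡ (suc k) (fsuc i) f = begin
  Id (suc k) (fsuc i) fzero *K f fzero +K sumK k (λ l → Id (suc k) (fsuc i) (fsuc l) *K f (fsuc l))
    ≡⟨ cong₂ _+K_ (cong (_*K f fzero) (Id-sym (suc k) (fsuc i) fzero))
                  (sumK-cong k (λ l → cong (_*K f (fsuc l)) (Id-suc k i l))) ⟩
  0K *K f fzero +K sumK k (λ l → Id k i l *K f (fsuc l))
    ≡⟨ cong (0K *K f fzero +K_) (sumK-Idˡ k i (λ l → f (fsuc l))) ⟩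
  0K *K f fzero +K f (fsuc i)
    ≡⟨ vanish (f fzero) (f (fsuc i)) ⟩
  f (fsuc i) ∎
  where
  open ≡-Reasoning
  vanish : ∀ x y → 0K *K x +K y ≡ y
  vanish = solve-∀ K-solverRing

sumK-Idʳ : ∀ k (j : Fin k) (f : Fin k → K) → sumK k (λ l → f l *K Id k l j) ≡ f j
sumK-Idʳ k j f =
  trans (sumK-cong k (λ l → trans (*K-comm (f l) (Id k l j)) (cong (_*K f l) (Id-sym k l j)))) (sumK-Idˡ k j f)

Mat-setoid : ℕ → Setoid _ _
Mat-setoid k = record
  { Carrier       = Mat k
  ; _≈_           = _≈M_
  ; isEquivalence = record
    { refl  = λ i j → refl
    ; sym   = λ A≈B i j → sym (A≈B i j)
    ; trans = λ A≈B B≈C i j → trans (A≈B i j) (B≈C i j) } }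

module ≈M-Reasoning {k : ℕ} = SetoidReasoning (Mat-setoid k)

≈M-sym : ∀ {k} {A B : Mat k} → A ≈M B → B ≈M A
≈M-sym = Setoid.sym (Mat-setoid _)

≈M-trans : ∀ {k} {A B C : Mat k} → A ≈M B → B ≈M C → A ≈M C
≈M-trans = Setoid.trans (Mat-setoid _)

module _ {k : ℕ} where

  ⊗-cong : {A A′ B B′ : Mat k} → A ≈M A′ → B ≈M B′ → A ⊗ B ≈M A′ ⊗ B′
  ⊗-cong A≈A′ B≈B′ i j = sumK-cong k (λ l → cong₂ _*K_ (A≈A′ i l) (B≈B′ l j))

  ⊖-cong : {A A′ B B′ : Mat k} → A ≈M A′ → B ≈M B′ → A ⊖ B ≈M A′ ⊖ B′
  ⊖-cong A≈A′ B≈B′ i j = cong₂ _-K_ (A≈A′ i j) (B≈B′ i j)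

  ⊗-congˡ : ∀ A {B B′ : Mat k} → B ≈M B′ → A ⊗ B ≈M A ⊗ B′
  ⊗-congˡ A = ⊗-cong {A = A} (λ i j → refl)

  ⊗-congʳ : ∀ B {A A′ : Mat k} → A ≈M A′ → A ⊗ B ≈M A′ ⊗ B
  ⊗-congʳ B A≈A′ = ⊗-cong {B = B} A≈A′ (λ i j → refl)

  ⊖-congˡ : ∀ A {B B′ : Mat k} → B ≈M B′ → A ⊖ B ≈M A ⊖ B′
  ⊖-congˡ A = ⊖-cong {A = A} (λ i j → refl)

  ·M-congˡ : ∀ c {A B : Mat k} → A ≈M B → c ·M A ≈M c ·M B
  ·M-congˡ c A≈B i j = cong (c *K_) (A≈B i j)

  ⊗-assoc : (A B C : Mat k) → (A ⊗ B) ⊗ C ≈M A ⊗ (B ⊗ C)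
  ⊗-assoc A B C i j = begin
    sumK k (λ l → sumK k (λ p → A i p *K B p l) *K C l j)
      ≡⟨ sumK-cong k (λ l → sumK-*ʳ k (C l j) (λ p → A i p *K B p l)) ⟨
    sumK k (λ l → sumK k (λ p → (A i p *K B p l) *K C l j))
      ≡⟨ sumK-comm k k (λ l p → (A i p *K B p l) *K C l j) ⟩
    sumK k (λ p → sumK k (λ l → (A i p *K B p l) *K C l j))
      ≡⟨ sumK-cong k (λ p → sumK-cong k (λ l → *K-assoc (A i p) (B p l) (C l j))) ⟩
    sumK k (λ p → sumK k (λ l → A i p *K (B p l *K C l j)))
      ≡⟨ sumK-cong k (λ p → sumK-*ˡ k (A i p) (λ l → B p l *K C l j)) ⟩
    sumK k (λ p → A i p *K sumK k (λ l → B p l *K C l j)) ∎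
    where open ≡-Reasoning

  ⊗-distribˡ-⊖ : (A B C : Mat k) → A ⊗ (B ⊖ C) ≈M A ⊗ B ⊖ A ⊗ C
  ⊗-distribˡ-⊖ A B C i j =
    trans (sumK-cong k (λ l → distrib (A i l) (B l j) (C l j)))
          (sumK-distrib-−K k (λ l → A i l *K B l j) (λ l → A i l *K C l j))
    where
    distrib : ∀ a b c → a *K (b -K c) ≡ a *K b -K a *K c
    distrib = solve-∀ K-solverRing

  ⊗-distribʳ-⊖ : (A B C : Mat k) → (A ⊖ B) ⊗ C ≈M A ⊗ C ⊖ B ⊗ C
  ⊗-distribʳ-⊖ A B C i j =
    trans (sumK-cong k (λ l → distrib (A i l) (B i l) (C l j)))
          (sumK-distrib-−K k (λ l → A i l *K C l j) (λ l → B i l *K C l j))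
    where
    distrib : ∀ a b c → (a -K b) *K c ≡ a *K c -K b *K c
    distrib = solve-∀ K-solverRing

  ·M-⊗ : ∀ c (A B : Mat k) → (c ·M A) ⊗ B ≈M c ·M (A ⊗ B)
  ·M-⊗ c A B i j = trans (sumK-cong k (λ l → *K-assoc c (A i l) (B l j)))
                         (sumK-*ˡ k c (λ l → A i l *K B l j))

  ⊗-·M : ∀ c (A B : Mat k) → A ⊗ (c ·M B) ≈M c ·M (A ⊗ B)
  ⊗-·M c A B i j = trans (sumK-cong k (λ l → swap c (A i l) (B l j)))
                         (sumK-*ˡ k c (λ l → A i l *K B l j))
    where
    swap : ∀ c a b → a *K (c *K b) ≡ c *K (a *K b)
    swap = solve-∀ K-solverRing

  ⊗-identityˡ : (A : Mat k) → Id k ⊗ A ≈M A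
  ⊗-identityˡ A i j = sumK-Idˡ k i (λ l → A l j)

  ⊗-identityʳ : (A : Mat k) → A ⊗ Id k ≈M A
  ⊗-identityʳ A i j = sumK-Idʳ k j (A i)

  Jm-⊗-Jm : Jm k ⊗ Jm k ≈M ofℕ k ·M Jm k
  Jm-⊗-Jm i j = trans (sumK-const k (1K *K 1K)) (*K-comm (1K *K 1K) (ofℕ k))

-- A criterion for the Moore–Penrose inverse

O : (k : ℕ) → Mat k
O k i j = 0K

module _ {k : ℕ} (a b : K) where

  aI-bJ-⊗ : (A : Mat k) → Jm k ⊗ A ≈M O k → (a ·M Id k ⊖ b ·M Jm k) ⊗ A ≈M a ·M A
  aI-bJ-⊗ A JA≈O = begin
    (a ·M Id k ⊖ b ·M Jm k) ⊗ A          ≈⟨ ⊗-distribʳ-⊖ (a ·M Id k) (b ·M Jm k) A ⟩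
    (a ·M Id k) ⊗ A ⊖ (b ·M Jm k) ⊗ A    ≈⟨ ⊖-cong (·M-⊗ a (Id k) A) (·M-⊗ b (Jm k) A) ⟩
    a ·M (Id k ⊗ A) ⊖ b ·M (Jm k ⊗ A)    ≈⟨ ⊖-cong (·M-congˡ a (⊗-identityˡ A)) (·M-congˡ b JA≈O) ⟩
    a ·M A ⊖ b ·M O k                    ≈⟨ (λ i j → vanish a b (A i j)) ⟩
    a ·M A                               ∎
    where
    open ≈M-Reasoning
    vanish : ∀ a b x → a *K x -K b *K 0K ≡ a *K x
    vanish = solve-∀ K-solverRing

  aI-bJ-symmetric : (a ·M Id k ⊖ b ·M Jm k) ᵀ ≈M a ·M Id k ⊖ b ·M Jm k
  aI-bJ-symmetric i j = cong (λ t → a *K t -K b *K 1K) (Id-sym k j i)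

symmetric-by : ∀ {k} {A C : Mat k} → A ≈M C → C ᵀ ≈M C → A ᵀ ≈M A
symmetric-by A≈C Cᵀ≈C i j = trans (A≈C j i) (trans (Cᵀ≈C i j) (sym (A≈C i j)))

*K-cancelˡ : ∀ ν a → ν *K a ≡ 1K → ∀ x → ν *K (a *K x) ≡ x
*K-cancelˡ ν a νa≡1 x = begin
  ν *K (a *K x)   ≡⟨ *K-assoc ν a x ⟨
  (ν *K a) *K x   ≡⟨ cong (_*K x) νa≡1 ⟩
  1K *K x         ≡⟨ *K-identityˡ x ⟩
  x               ∎
  where open ≡-Reasoning

·M-cancel : ∀ {k} (ν a : K) → ν *K a ≡ 1K → (A : Mat k) → ν ·M (a ·M A) ≈M A
·M-cancel ν a νa≡1 A i j = *K-cancelˡ ν a νa≡1 (A i j)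

moorePenrose-criterion : ∀ {k} (L H : Mat k) (a b ν : K) → ν *K a ≡ 1K →
  L ⊗ H ≈M a ·M Id k ⊖ b ·M Jm k → H ⊗ L ≈M a ·M Id k ⊖ b ·M Jm k →
  Jm k ⊗ L ≈M O k → Jm k ⊗ H ≈M O k →
  IsMoorePenroseInverse L (ν ·M H)
moorePenrose-criterion {k} L H a b ν νa≡1 LH≈P HL≈P JL≈O JH≈O =
  LGL≈L , GLG≈G , symmetric-by LG≈νP (·M-congˡ ν (aI-bJ-symmetric a b)) ,
  symmetric-by GL≈νP (·M-congˡ ν (aI-bJ-symmetric a b))
  where
  open ≈M-Reasoning
  P = a ·M Id k ⊖ b ·M Jm k
  G = ν ·M H
  LG≈νP : L ⊗ G ≈M ν ·M P
  LG≈νP = begin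
    L ⊗ G          ≈⟨ ⊗-·M ν L H ⟩
    ν ·M (L ⊗ H)   ≈⟨ ·M-congˡ ν LH≈P ⟩
    ν ·M P         ∎
  GL≈νP : G ⊗ L ≈M ν ·M P
  GL≈νP = begin
    G ⊗ L          ≈⟨ ·M-⊗ ν H L ⟩
    ν ·M (H ⊗ L)   ≈⟨ ·M-congˡ ν HL≈P ⟩
    ν ·M P         ∎
  LGL≈L : L ⊗ G ⊗ L ≈M L
  LGL≈L = begin
    L ⊗ G ⊗ L          ≈⟨ ⊗-congʳ L LG≈νP ⟩
    (ν ·M P) ⊗ L       ≈⟨ ·M-⊗ ν P L ⟩
    ν ·M (P ⊗ L)       ≈⟨ ·M-congˡ ν (aI-bJ-⊗ a b L JL≈O) ⟩
    ν ·M (a ·M L)      ≈⟨ ·M-cancel ν a νa≡1 L ⟩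
    L                  ∎
  GLG≈G : G ⊗ L ⊗ G ≈M G
  GLG≈G = begin
    G ⊗ L ⊗ G              ≈⟨ ⊗-congʳ G GL≈νP ⟩
    (ν ·M P) ⊗ G           ≈⟨ ·M-⊗ ν P G ⟩
    ν ·M (P ⊗ G)           ≈⟨ ·M-congˡ ν (⊗-·M ν P H) ⟩
    ν ·M (ν ·M (P ⊗ H))    ≈⟨ ·M-congˡ ν (·M-congˡ ν (aI-bJ-⊗ a b H JH≈O)) ⟩
    ν ·M (ν ·M (a ·M H))   ≈⟨ ·M-congˡ ν (·M-cancel ν a νa≡1 H) ⟩
    G                      ∎

bordered : (m : ℕ) → Mat m → Mat (suc m)
bordered m M = block (ofℕ m) (λ i → -K ones m i) (λ i → -K ones m i) M

module _ {k : ℕ} (M : Mat k) where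

  sumK-row : M ⊗ Jm k ≈M Jm k → ∀ i c → sumK k (λ l → M i l *K c) ≡ c
  sumK-row MJ≈J i c = begin
    sumK k (λ l → M i l *K c)              ≡⟨ sumK-*ʳ k c (M i) ⟩
    sumK k (M i) *K c                      ≡⟨ cong (_*K c) (sumK-cong k (λ l → *K-identityʳ (M i l))) ⟨
    sumK k (λ l → M i l *K 1K) *K c        ≡⟨ cong (_*K c) (MJ≈J i i) ⟩
    1K *K c                                ≡⟨ *K-identityˡ c ⟩
    c                                      ∎
    where open ≡-Reasoning

  sumK-column : Jm k ⊗ M ≈M Jm k → ∀ j c → sumK k (λ l → c *K M l j) ≡ c
  sumK-column JM≈J j c = begin
    sumK k (λ l → c *K M l j)              ≡⟨ sumK-*ˡ k c (λ l → M l j) ⟩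
    c *K sumK k (λ l → M l j)              ≡⟨ cong (c *K_) (sumK-cong k (λ l → *K-identityˡ (M l j))) ⟨
    c *K sumK k (λ l → 1K *K M l j)        ≡⟨ cong (c *K_) (JM≈J j j) ⟩
    c *K 1K                                ≡⟨ *K-identityʳ c ⟩
    c                                      ∎
    where open ≡-Reasoning

module _ (m : ℕ) where
  private
    a n : K
    a = ofℕ m
    n = ofℕ (suc m)

  bordered-⊗-bordered : (M M′ : Mat m) → M ⊗ Jm m ≈M Jm m → Jm m ⊗ M′ ≈M Jm m →
    M ⊗ M′ ≈M (n *K n) ·M Id m ⊖ (n +K 1K) ·M Jm m →
    bordered m M ⊗ bordered m M′ ≈M (n *K n) ·M Id (suc m) ⊖ n ·M Jm (suc m)
  bordered-⊗-bordered M M′ MJ≈J JM′≈J MM′≈ fzero fzero = begin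
    a *K a +K sumK m (λ _ → (-K 1K) *K (-K 1K))  ≡⟨ cong (a *K a +K_) (sumK-const m ((-K 1K) *K (-K 1K))) ⟩
    a *K a +K ((-K 1K) *K (-K 1K)) *K a          ≡⟨ identity a ⟩
    ((a +K 1K) *K (a +K 1K)) *K 1K -K (a +K 1K) *K 1K
                                                 ≡⟨ cong (λ t → (t *K t) *K 1K -K t *K 1K) (ofℕ-suc m) ⟨
    (n *K n) *K 1K -K n *K 1K                    ∎
    where
    open ≡-Reasoning
    identity : ∀ a → a *K a +K ((-K 1K) *K (-K 1K)) *K a ≡ ((a +K 1K) *K (a +K 1K)) *K 1K -K (a +K 1K) *K 1K
    identity = solve-∀ K-solverRing
  bordered-⊗-bordered M M′ MJ≈J JM′≈J MM′≈ fzero (fsuc j) = begin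
    a *K (-K 1K) +K sumK m (λ l → (-K 1K) *K M′ l j)  ≡⟨ cong (a *K (-K 1K) +K_) (sumK-column M′ JM′≈J j (-K 1K)) ⟩
    a *K (-K 1K) +K (-K 1K)                           ≡⟨ identity a ⟩
    ((a +K 1K) *K (a +K 1K)) *K 0K -K (a +K 1K) *K 1K ≡⟨ cong (λ t → (t *K t) *K 0K -K t *K 1K) (ofℕ-suc m) ⟨
    (n *K n) *K 0K -K n *K 1K                         ∎
    where
    open ≡-Reasoning
    identity : ∀ a → a *K (-K 1K) +K (-K 1K) ≡ ((a +K 1K) *K (a +K 1K)) *K 0K -K (a +K 1K) *K 1K
    identity = solve-∀ K-solverRing
  bordered-⊗-bordered M M′ MJ≈J JM′≈J MM′≈ (fsuc i) fzero = begin
    (-K 1K) *K a +K sumK m (λ l → M i l *K (-K 1K))   ≡⟨ cong ((-K 1K) *K a +K_) (sumK-row M MJ≈J i (-K 1K)) ⟩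
    (-K 1K) *K a +K (-K 1K)                           ≡⟨ identity a ⟩
    ((a +K 1K) *K (a +K 1K)) *K 0K -K (a +K 1K) *K 1K ≡⟨ cong (λ t → (t *K t) *K 0K -K t *K 1K) (ofℕ-suc m) ⟨
    (n *K n) *K 0K -K n *K 1K                         ∎
    where
    open ≡-Reasoning
    identity : ∀ a → (-K 1K) *K a +K (-K 1K) ≡ ((a +K 1K) *K (a +K 1K)) *K 0K -K (a +K 1K) *K 1K
    identity = solve-∀ K-solverRing
  bordered-⊗-bordered M M′ MJ≈J JM′≈J MM′≈ (fsuc i) (fsuc j) = begin
    (-K 1K) *K (-K 1K) +K (M ⊗ M′) i j                               ≡⟨ cong ((-K 1K) *K (-K 1K) +K_) (MM′≈ i j) ⟩
    (-K 1K) *K (-K 1K) +K ((n *K n) *K Id m i j -K (n +K 1K) *K 1K)  ≡⟨ identity n (Id m i j) ⟩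
    (n *K n) *K Id m i j -K n *K 1K                                  ≡⟨ cong (λ t → (n *K n) *K t -K n *K 1K) (Id-suc m i j) ⟨
    (n *K n) *K Id (suc m) (fsuc i) (fsuc j) -K n *K 1K              ∎
    where
    open ≡-Reasoning
    identity : ∀ n d → (-K 1K) *K (-K 1K) +K ((n *K n) *K d -K (n +K 1K) *K 1K) ≡ (n *K n) *K d -K n *K 1K
    identity = solve-∀ K-solverRing

  Jm-⊗-bordered : (M : Mat m) → Jm m ⊗ M ≈M Jm m → Jm (suc m) ⊗ bordered m M ≈M O (suc m)
  Jm-⊗-bordered M JM≈J i fzero = begin
    1K *K a +K sumK m (λ _ → 1K *K (-K 1K))   ≡⟨ cong (1K *K a +K_) (sumK-const m (1K *K (-K 1K))) ⟩
    1K *K a +K (1K *K (-K 1K)) *K a           ≡⟨ cancel a ⟩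
    0K                                        ∎
    where
    open ≡-Reasoning
    cancel : ∀ a → 1K *K a +K (1K *K (-K 1K)) *K a ≡ 0K
    cancel = solve-∀ K-solverRing
  Jm-⊗-bordered M JM≈J i (fsuc j) = begin
    1K *K (-K 1K) +K sumK m (λ l → 1K *K M l j)   ≡⟨ cong (1K *K (-K 1K) +K_) (sumK-column M JM≈J j 1K) ⟩
    1K *K (-K 1K) +K 1K                           ≡⟨ +K-inverseˡ 1K ⟩
    0K                                            ∎
    where open ≡-Reasoning

-- Inverses from the relation BX = XB = J - nI

module BorderedInverse (m : ℕ) (B X : Mat m)
  (BJ≈J : B ⊗ Jm m ≈M Jm m) (JB≈J : Jm m ⊗ B ≈M Jm m)
  (BX≈ : B ⊗ X ≈M Jm m ⊖ ofℕ (suc m) ·M Id m)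
  (XB≈ : X ⊗ B ≈M Jm m ⊖ ofℕ (suc m) ·M Id m)
  where

  open ≈M-Reasoning

  a n : K
  a = ofℕ m
  n = ofℕ (suc m)

  J-nI : Mat m
  J-nI = Jm m ⊖ n ·M Id m

  -J : Mat m
  -J = (-K 1K) ·M Jm m

  aJ-nJ≈-J : a ·M Jm m ⊖ n ·M Jm m ≈M -J
  aJ-nJ≈-J i j = trans (cong (λ t → a *K 1K -K t *K 1K) (ofℕ-suc m)) (identity a)
    where
    identity : ∀ a → a *K 1K -K (a +K 1K) *K 1K ≡ (-K 1K) *K 1K
    identity = solve-∀ K-solverRing

  J⊗J-nI : Jm m ⊗ J-nI ≈M -J
  J⊗J-nI = begin
    Jm m ⊗ J-nI                           ≈⟨ ⊗-distribˡ-⊖ (Jm m) (Jm m) (n ·M Id m) ⟩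
    Jm m ⊗ Jm m ⊖ Jm m ⊗ (n ·M Id m)      ≈⟨ ⊖-cong Jm-⊗-Jm (⊗-·M n (Jm m) (Id m)) ⟩
    a ·M Jm m ⊖ n ·M (Jm m ⊗ Id m)        ≈⟨ ⊖-congˡ (a ·M Jm m) (·M-congˡ n (⊗-identityʳ (Jm m))) ⟩
    a ·M Jm m ⊖ n ·M Jm m                 ≈⟨ aJ-nJ≈-J ⟩
    -J                                    ∎

  J-nI⊗J : J-nI ⊗ Jm m ≈M -J
  J-nI⊗J = begin
    J-nI ⊗ Jm m                           ≈⟨ ⊗-distribʳ-⊖ (Jm m) (n ·M Id m) (Jm m) ⟩
    Jm m ⊗ Jm m ⊖ (n ·M Id m) ⊗ Jm m      ≈⟨ ⊖-cong Jm-⊗-Jm (·M-⊗ n (Id m) (Jm m)) ⟩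
    a ·M Jm m ⊖ n ·M (Id m ⊗ Jm m)        ≈⟨ ⊖-congˡ (a ·M Jm m) (·M-congˡ n (⊗-identityˡ (Jm m))) ⟩
    a ·M Jm m ⊖ n ·M Jm m                 ≈⟨ aJ-nJ≈-J ⟩
    -J                                    ∎

  XJ≈-J : X ⊗ Jm m ≈M -J
  XJ≈-J = begin
    X ⊗ Jm m         ≈⟨ ⊗-congˡ X BJ≈J ⟨
    X ⊗ (B ⊗ Jm m)   ≈⟨ ⊗-assoc X B (Jm m) ⟨
    X ⊗ B ⊗ Jm m     ≈⟨ ⊗-congʳ (Jm m) XB≈ ⟩
    J-nI ⊗ Jm m      ≈⟨ J-nI⊗J ⟩
    -J               ∎

  JX≈-J : Jm m ⊗ X ≈M -J
  JX≈-J = begin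
    Jm m ⊗ X         ≈⟨ ⊗-congʳ X JB≈J ⟨
    Jm m ⊗ B ⊗ X     ≈⟨ ⊗-assoc (Jm m) B X ⟩
    Jm m ⊗ (B ⊗ X)   ≈⟨ ⊗-congˡ (Jm m) BX≈ ⟩
    Jm m ⊗ J-nI      ≈⟨ J⊗J-nI ⟩
    -J               ∎

  ν : K
  ν = invK n

  Minv : Mat m
  Minv = ν ·M (Jm m ⊖ X)

  ν-cancel : ∀ c d → ν *K (c -K (c -K n *K d)) ≡ d
  ν-cancel c d = trans (regroup ν n c d) (*K-cancelˡ ν n (invK-ofℕ-suc m) d)
    where
    regroup : ∀ ν n c d → ν *K (c -K (c -K n *K d)) ≡ ν *K (n *K d)
    regroup = solve-∀ K-solverRing

  BMinv≈I : B ⊗ Minv ≈M Id m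
  BMinv≈I = begin
    B ⊗ Minv                       ≈⟨ ⊗-·M ν B (Jm m ⊖ X) ⟩
    ν ·M (B ⊗ (Jm m ⊖ X))          ≈⟨ ·M-congˡ ν (⊗-distribˡ-⊖ B (Jm m) X) ⟩
    ν ·M (B ⊗ Jm m ⊖ B ⊗ X)        ≈⟨ ·M-congˡ ν (⊖-cong BJ≈J BX≈) ⟩
    ν ·M (Jm m ⊖ J-nI)             ≈⟨ (λ i j → ν-cancel 1K (Id m i j)) ⟩
    Id m                           ∎

  MinvB≈I : Minv ⊗ B ≈M Id m
  MinvB≈I = begin
    Minv ⊗ B                       ≈⟨ ·M-⊗ ν (Jm m ⊖ X) B ⟩
    ν ·M ((Jm m ⊖ X) ⊗ B)          ≈⟨ ·M-congˡ ν (⊗-distribʳ-⊖ (Jm m) X B) ⟩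
    ν ·M (Jm m ⊗ B ⊖ X ⊗ B)        ≈⟨ ·M-congˡ ν (⊖-cong JB≈J XB≈) ⟩
    ν ·M (Jm m ⊖ J-nI)             ≈⟨ (λ i j → ν-cancel 1K (Id m i j)) ⟩
    Id m                           ∎

  isInverse : {M : Mat m} → M ≈M B → IsInverse M Minv
  isInverse M≈B = ≈M-trans (⊗-congʳ Minv M≈B) BMinv≈I , ≈M-trans (⊗-congˡ Minv M≈B) MinvB≈I

  XJ-nI≈ : X ⊗ J-nI ≈M -J ⊖ n ·M X
  XJ-nI≈ = begin
    X ⊗ J-nI                       ≈⟨ ⊗-distribˡ-⊖ X (Jm m) (n ·M Id m) ⟩
    X ⊗ Jm m ⊖ X ⊗ (n ·M Id m)     ≈⟨ ⊖-cong XJ≈-J (⊗-·M n X (Id m)) ⟩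
    -J ⊖ n ·M (X ⊗ Id m)           ≈⟨ ⊖-congˡ -J (·M-congˡ n (⊗-identityʳ X)) ⟩
    -J ⊖ n ·M X                    ∎

  MinvJ-nI≈X : Minv ⊗ J-nI ≈M X
  MinvJ-nI≈X = begin
    Minv ⊗ J-nI                        ≈⟨ ·M-⊗ ν (Jm m ⊖ X) J-nI ⟩
    ν ·M ((Jm m ⊖ X) ⊗ J-nI)           ≈⟨ ·M-congˡ ν (⊗-distribʳ-⊖ (Jm m) X J-nI) ⟩
    ν ·M (Jm m ⊗ J-nI ⊖ X ⊗ J-nI)      ≈⟨ ·M-congˡ ν (⊖-cong J⊗J-nI XJ-nI≈) ⟩
    ν ·M (-J ⊖ (-J ⊖ n ·M X))          ≈⟨ (λ i j → ν-cancel ((-K 1K) *K 1K) (X i j)) ⟩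
    X                                  ∎

  Y : Mat m
  Y = -J ⊖ n ·M X

  -a-nJ≈J : (-K 1K) ·M (a ·M Jm m) ⊖ n ·M -J ≈M Jm m
  -a-nJ≈J i j = trans (cong (λ t → (-K 1K) *K (a *K 1K) -K t *K ((-K 1K) *K 1K)) (ofℕ-suc m)) (identity a)
    where
    identity : ∀ a → (-K 1K) *K (a *K 1K) -K (a +K 1K) *K ((-K 1K) *K 1K) ≡ 1K
    identity = solve-∀ K-solverRing

  YJ≈J : Y ⊗ Jm m ≈M Jm m
  YJ≈J = begin
    Y ⊗ Jm m                                       ≈⟨ ⊗-distribʳ-⊖ -J (n ·M X) (Jm m) ⟩
    -J ⊗ Jm m ⊖ (n ·M X) ⊗ Jm m                    ≈⟨ ⊖-cong (·M-⊗ (-K 1K) (Jm m) (Jm m)) (·M-⊗ n X (Jm m)) ⟩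
    (-K 1K) ·M (Jm m ⊗ Jm m) ⊖ n ·M (X ⊗ Jm m)     ≈⟨ ⊖-cong (·M-congˡ (-K 1K) Jm-⊗-Jm) (·M-congˡ n XJ≈-J) ⟩
    (-K 1K) ·M (a ·M Jm m) ⊖ n ·M -J               ≈⟨ -a-nJ≈J ⟩
    Jm m                                           ∎

  JY≈J : Jm m ⊗ Y ≈M Jm m
  JY≈J = begin
    Jm m ⊗ Y                                       ≈⟨ ⊗-distribˡ-⊖ (Jm m) -J (n ·M X) ⟩
    Jm m ⊗ -J ⊖ Jm m ⊗ (n ·M X)                    ≈⟨ ⊖-cong (⊗-·M (-K 1K) (Jm m) (Jm m)) (⊗-·M n (Jm m) X) ⟩
    (-K 1K) ·M (Jm m ⊗ Jm m) ⊖ n ·M (Jm m ⊗ X)     ≈⟨ ⊖-cong (·M-congˡ (-K 1K) Jm-⊗-Jm) (·M-congˡ n JX≈-J) ⟩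
    (-K 1K) ·M (a ·M Jm m) ⊖ n ·M -J               ≈⟨ -a-nJ≈J ⟩
    Jm m                                           ∎

  -J-nJ-nI≈ : -J ⊖ n ·M J-nI ≈M (n *K n) ·M Id m ⊖ (n +K 1K) ·M Jm m
  -J-nJ-nI≈ i j = identity n (Id m i j)
    where
    identity : ∀ n d → (-K 1K) *K 1K -K n *K (1K -K n *K d) ≡ (n *K n) *K d -K (n +K 1K) *K 1K
    identity = solve-∀ K-solverRing

  BY≈ : B ⊗ Y ≈M (n *K n) ·M Id m ⊖ (n +K 1K) ·M Jm m
  BY≈ = begin
    B ⊗ Y                                ≈⟨ ⊗-distribˡ-⊖ B -J (n ·M X) ⟩
    B ⊗ -J ⊖ B ⊗ (n ·M X)                ≈⟨ ⊖-cong (⊗-·M (-K 1K) B (Jm m)) (⊗-·M n B X) ⟩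
    (-K 1K) ·M (B ⊗ Jm m) ⊖ n ·M (B ⊗ X) ≈⟨ ⊖-cong (·M-congˡ (-K 1K) BJ≈J) (·M-congˡ n BX≈) ⟩
    -J ⊖ n ·M J-nI                       ≈⟨ -J-nJ-nI≈ ⟩
    (n *K n) ·M Id m ⊖ (n +K 1K) ·M Jm m ∎

  YB≈ : Y ⊗ B ≈M (n *K n) ·M Id m ⊖ (n +K 1K) ·M Jm m
  YB≈ = begin
    Y ⊗ B                                ≈⟨ ⊗-distribʳ-⊖ -J (n ·M X) B ⟩
    -J ⊗ B ⊖ (n ·M X) ⊗ B                ≈⟨ ⊖-cong (·M-⊗ (-K 1K) (Jm m) B) (·M-⊗ n X B) ⟩
    (-K 1K) ·M (Jm m ⊗ B) ⊖ n ·M (X ⊗ B) ≈⟨ ⊖-cong (·M-congˡ (-K 1K) JB≈J) (·M-congˡ n XB≈) ⟩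
    -J ⊖ n ·M J-nI                       ≈⟨ -J-nJ-nI≈ ⟩
    (n *K n) ·M Id m ⊖ (n +K 1K) ·M Jm m ∎

  isMoorePenroseInverse : IsMoorePenroseInverse (bordered m B) (invK (n *K n) ·M bordered m Y)
  isMoorePenroseInverse = moorePenrose-criterion (bordered m B) (bordered m Y)
    (n *K n) n (invK (n *K n)) (invK-ofℕ-suc² m)
    (bordered-⊗-bordered m B Y BJ≈J JY≈J BY≈) (bordered-⊗-bordered m Y B YJ≈J JB≈J YB≈)
    (Jm-⊗-bordered m B JB≈J) (Jm-⊗-bordered m Y JY≈J)

-- Cyclic shifts of Fin m and circulant matrices

module Cyclic (m′ : ℕ) where

  open import Data.Nat using (_+_; _∸_; _%_)
  open import Data.Nat.Properties
    using (+-assoc; +-comm; +-∸-comm; m+[n∸m]≡n; m∸n+n≡m; m≤m+n; <⇒≤; ≤-trans)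
  open import Data.Nat.DivMod using (m%n<n; %-distribˡ-+; m%n%n≡m%n; [m+n]%n≡m%n; m<n⇒m%n≡m)
  open import Data.Fin using (fromℕ<)
  open import Data.Fin.Properties using (toℕ<n; toℕ-fromℕ<)
  open ≡-Reasoning

  m : ℕ
  m = suc m′

  %-absorbˡ : ∀ x y → (x % m + y) % m ≡ (x + y) % m
  %-absorbˡ x y = begin
    (x % m + y) % m              ≡⟨ %-distribˡ-+ (x % m) y m ⟩
    (x % m % m + y % m) % m      ≡⟨ cong (λ t → (t + y % m) % m) (m%n%n≡m%n x m) ⟩
    (x % m + y % m) % m          ≡⟨ %-distribˡ-+ x y m ⟨
    (x + y) % m                  ∎

  %-absorbʳ : ∀ x y → (x + y % m) % m ≡ (x + y) % m
  %-absorbʳ x y = begin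
    (x + y % m) % m   ≡⟨ cong (_% m) (+-comm x (y % m)) ⟩
    (y % m + x) % m   ≡⟨ %-absorbˡ y x ⟩
    (y + x) % m       ≡⟨ cong (_% m) (+-comm y x) ⟩
    (x + y) % m       ∎

  toℕ%m : ∀ (i : Fin m) → toℕ i % m ≡ toℕ i
  toℕ%m i = m<n⇒m%n≡m (toℕ<n i)

  infixl 6 _⊞_

  _⊞_ : Fin m → ℕ → Fin m
  i ⊞ t = fromℕ< (m%n<n (toℕ i + t) m)

  toℕ-⊞ : ∀ i t → toℕ (i ⊞ t) ≡ (toℕ i + t) % m
  toℕ-⊞ i t = toℕ-fromℕ< (m%n<n (toℕ i + t) m)

  ⊞-identityʳ : ∀ i → i ⊞ 0 ≡ i
  ⊞-identityʳ i = toℕ-injective (trans (toℕ-⊞ i 0) (trans (cong (_% m) (+-comm (toℕ i) 0)) (toℕ%m i)))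

  ⊞-assoc : ∀ i t s → i ⊞ t ⊞ s ≡ i ⊞ (t + s)
  ⊞-assoc i t s = toℕ-injective (begin
    toℕ (i ⊞ t ⊞ s)              ≡⟨ toℕ-⊞ (i ⊞ t) s ⟩
    (toℕ (i ⊞ t) + s) % m        ≡⟨ cong (λ x → (x + s) % m) (toℕ-⊞ i t) ⟩
    ((toℕ i + t) % m + s) % m    ≡⟨ %-absorbˡ (toℕ i + t) s ⟩
    (toℕ i + t + s) % m          ≡⟨ cong (_% m) (+-assoc (toℕ i) t s) ⟩
    (toℕ i + (t + s)) % m        ≡⟨ toℕ-⊞ i (t + s) ⟨
    toℕ (i ⊞ (t + s))            ∎)

  ⊞-% : ∀ i t → i ⊞ t % m ≡ i ⊞ t
  ⊞-% i t = toℕ-injective (trans (toℕ-⊞ i (t % m)) (trans (%-absorbʳ (toℕ i) t) (sym (toℕ-⊞ i t))))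

  ⊞-period : ∀ i → i ⊞ m ≡ i
  ⊞-period i = toℕ-injective (trans (toℕ-⊞ i m) (trans ([m+n]%n≡m%n (toℕ i) m) (toℕ%m i)))

  ⊞-cancel : ∀ i {t s} → t + s ≡ m → i ⊞ t ⊞ s ≡ i
  ⊞-cancel i {t} {s} t+s≡m = trans (⊞-assoc i t s) (trans (cong (i ⊞_) t+s≡m) (⊞-period i))

  -- circ m c i j reduces to c (offset i j)
  offset : Fin m → Fin m → ℕ
  offset i j = (m + toℕ j ∸ toℕ i) % m

  offset< : ∀ i j → offset i j < m
  offset< i j = m%n<n (m + toℕ j ∸ toℕ i) m

  offset≡ : ∀ i j → offset i j ≡ ((m ∸ toℕ i) + toℕ j) % m
  offset≡ i j = cong (_% m) (+-∸-comm (toℕ j) (<⇒≤ (toℕ<n i)))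

  ⊞-offset : ∀ i j → i ⊞ offset i j ≡ j
  ⊞-offset i j = toℕ-injective (begin
    toℕ (i ⊞ offset i j)                        ≡⟨ toℕ-⊞ i (offset i j) ⟩
    (toℕ i + offset i j) % m                    ≡⟨ %-absorbʳ (toℕ i) (m + toℕ j ∸ toℕ i) ⟩
    (toℕ i + (m + toℕ j ∸ toℕ i)) % m           ≡⟨ cong (_% m) (m+[n∸m]≡n (≤-trans (<⇒≤ (toℕ<n i)) (m≤m+n m (toℕ j)))) ⟩
    (m + toℕ j) % m                             ≡⟨ cong (_% m) (+-comm m (toℕ j)) ⟩
    (toℕ j + m) % m                             ≡⟨ [m+n]%n≡m%n (toℕ j) m ⟩
    toℕ j % m                                   ≡⟨ toℕ%m j ⟩
    toℕ j                                       ∎)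

  offset-⊞ : ∀ i {t} → t < m → offset i (i ⊞ t) ≡ t
  offset-⊞ i {t} t<m = begin
    offset i (i ⊞ t)                                  ≡⟨ offset≡ i (i ⊞ t) ⟩
    ((m ∸ toℕ i) + toℕ (i ⊞ t)) % m                   ≡⟨ cong (λ x → ((m ∸ toℕ i) + x) % m) (toℕ-⊞ i t) ⟩
    ((m ∸ toℕ i) + (toℕ i + t) % m) % m               ≡⟨ %-absorbʳ (m ∸ toℕ i) (toℕ i + t) ⟩
    ((m ∸ toℕ i) + (toℕ i + t)) % m                   ≡⟨ cong (_% m) (+-assoc (m ∸ toℕ i) (toℕ i) t) ⟨
    ((m ∸ toℕ i) + toℕ i + t) % m                     ≡⟨ cong (λ x → (x + t) % m) (m∸n+n≡m (<⇒≤ (toℕ<n i))) ⟩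
    (m + t) % m                                       ≡⟨ cong (_% m) (+-comm m t) ⟩
    (t + m) % m                                       ≡⟨ [m+n]%n≡m%n t m ⟩
    t % m                                             ≡⟨ m<n⇒m%n≡m t<m ⟩
    t                                                 ∎

  offset≡⇒⊞≡ : ∀ i j {t} → offset i j ≡ t → i ⊞ t ≡ j
  offset≡⇒⊞≡ i j o≡t = trans (cong (i ⊞_) (sym o≡t)) (⊞-offset i j)

  ⊞≡⇒offset≡ : ∀ i j {t} → t < m → i ⊞ t ≡ j → offset i j ≡ t
  ⊞≡⇒offset≡ i j t<m i⊞t≡j = trans (cong (offset i) (sym i⊞t≡j)) (offset-⊞ i t<m)

  offset-⊞ʳ : ∀ i j u → offset i (j ⊞ u) ≡ (offset i j + u) % m
  offset-⊞ʳ i j u = ⊞≡⇒offset≡ i (j ⊞ u) (m%n<n (offset i j + u) m) (begin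
    i ⊞ (offset i j + u) % m   ≡⟨ ⊞-% i (offset i j + u) ⟩
    i ⊞ (offset i j + u)       ≡⟨ ⊞-assoc i (offset i j) u ⟨
    i ⊞ offset i j ⊞ u         ≡⟨ cong (_⊞ u) (⊞-offset i j) ⟩
    j ⊞ u                      ∎)

  offset-⊞ˡ : ∀ i j {t s} → t + s ≡ m → offset (i ⊞ t) j ≡ (offset i j + s) % m
  offset-⊞ˡ i j {t} {s} t+s≡m = ⊞≡⇒offset≡ (i ⊞ t) j (m%n<n (offset i j + s) m) (begin
    i ⊞ t ⊞ (offset i j + s) % m   ≡⟨ ⊞-% (i ⊞ t) (offset i j + s) ⟩
    i ⊞ t ⊞ (offset i j + s)       ≡⟨ ⊞-assoc i t (offset i j + s) ⟩
    i ⊞ (t + (offset i j + s))     ≡⟨ cong (i ⊞_) (shuffle t (offset i j) s) ⟩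
    i ⊞ (offset i j + (t + s))     ≡⟨ ⊞-assoc i (offset i j) (t + s) ⟨
    i ⊞ offset i j ⊞ (t + s)       ≡⟨ cong₂ _⊞_ (⊞-offset i j) t+s≡m ⟩
    j ⊞ m                          ≡⟨ ⊞-period j ⟩
    j                              ∎)
    where
    open import Data.Nat.Tactic.RingSolver using () renaming (solve-∀ to solve-ℕ)
    shuffle : ∀ t o s → t + (o + s) ≡ o + (t + s)
    shuffle = solve-ℕ

  S : ℕ → Mat m
  S t i j = Id m (i ⊞ t) j

  δ-offset : ∀ i j {t} → t < m → δ (offset i j) t ≡ S t i j
  δ-offset i j {t} t<m = trans
    (δ-cong-⇔ (cong toℕ ∘ offset≡⇒⊞≡ i j) (⊞≡⇒offset≡ i j t<m ∘ toℕ-injective))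
    (sym (Id-δ m (i ⊞ t) j))

  S-transpose : ∀ {t s} → t + s ≡ m → S t ᵀ ≈M S s
  S-transpose {t} {s} t+s≡m i j = Id-cong-⇔
    (λ j⊞t≡i → trans (cong (_⊞ s) (sym j⊞t≡i)) (⊞-cancel j t+s≡m))
    (λ i⊞s≡j → trans (cong (_⊞ t) (sym i⊞s≡j)) (⊞-cancel i (trans (+-comm s t) t+s≡m)))

  S-⊗ : ∀ t (A : Mat m) → S t ⊗ A ≈M λ i j → A (i ⊞ t) j
  S-⊗ t A i j = sumK-Idˡ m (i ⊞ t) (λ l → A l j)

  ⊗-S : ∀ {t s} → t + s ≡ m → (A : Mat m) → A ⊗ S t ≈M λ i j → A i (j ⊞ s)
  ⊗-S {t} {s} t+s≡m A i j = trans
    (sumK-cong m (λ l → cong (A i l *K_) (trans (S-transpose t+s≡m j l) (Id-sym m (j ⊞ s) l))))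
    (sumK-Idʳ m (j ⊞ s) (A i))

  -- 3I - P - P⁻¹ for the cyclic shift P, i.e. circ(3,-1,0,…,0,-1)
  stencil : Mat m
  stencil = ofℕ 3 ·M Id m ⊖ S 1 ⊖ S m′

  stencil-⊗ : (A : Mat m) → stencil ⊗ A ≈M λ i j → ofℕ 3 *K A i j -K A (i ⊞ 1) j -K A (i ⊞ m′) j
  stencil-⊗ A i j = begin
    (stencil ⊗ A) i j
      ≡⟨ ⊗-distribʳ-⊖ (ofℕ 3 ·M Id m ⊖ S 1) (S m′) A i j ⟩
    ((ofℕ 3 ·M Id m ⊖ S 1) ⊗ A) i j -K (S m′ ⊗ A) i j
      ≡⟨ cong (_-K (S m′ ⊗ A) i j) (⊗-distribʳ-⊖ (ofℕ 3 ·M Id m) (S 1) A i j) ⟩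
    ((ofℕ 3 ·M Id m) ⊗ A) i j -K (S 1 ⊗ A) i j -K (S m′ ⊗ A) i j
      ≡⟨ cong₂ (λ x y → x -K y -K (S m′ ⊗ A) i j)
           (trans (·M-⊗ (ofℕ 3) (Id m) A i j) (cong (ofℕ 3 *K_) (⊗-identityˡ A i j))) (S-⊗ 1 A i j) ⟩
    ofℕ 3 *K A i j -K A (i ⊞ 1) j -K (S m′ ⊗ A) i j
      ≡⟨ cong (_-K_ (ofℕ 3 *K A i j -K A (i ⊞ 1) j)) (S-⊗ m′ A i j) ⟩
    ofℕ 3 *K A i j -K A (i ⊞ 1) j -K A (i ⊞ m′) j ∎

  ⊗-stencil : (A : Mat m) → A ⊗ stencil ≈M λ i j → ofℕ 3 *K A i j -K A i (j ⊞ m′) -K A i (j ⊞ 1)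
  ⊗-stencil A i j = begin
    (A ⊗ stencil) i j
      ≡⟨ ⊗-distribˡ-⊖ A (ofℕ 3 ·M Id m ⊖ S 1) (S m′) i j ⟩
    (A ⊗ (ofℕ 3 ·M Id m ⊖ S 1)) i j -K (A ⊗ S m′) i j
      ≡⟨ cong (_-K (A ⊗ S m′) i j) (⊗-distribˡ-⊖ A (ofℕ 3 ·M Id m) (S 1) i j) ⟩
    (A ⊗ (ofℕ 3 ·M Id m)) i j -K (A ⊗ S 1) i j -K (A ⊗ S m′) i j
      ≡⟨ cong₂ (λ x y → x -K y -K (A ⊗ S m′) i j)
           (trans (⊗-·M (ofℕ 3) A (Id m) i j) (cong (ofℕ 3 *K_) (⊗-identityʳ A i j))) (⊗-S refl A i j) ⟩
    ofℕ 3 *K A i j -K A i (j ⊞ m′) -K (A ⊗ S m′) i j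
      ≡⟨ cong (_-K_ (ofℕ 3 *K A i j -K A i (j ⊞ m′))) (⊗-S (+-comm m′ 1) A i j) ⟩
    ofℕ 3 *K A i j -K A i (j ⊞ m′) -K A i (j ⊞ 1) ∎

  δ-offset-0 : ∀ i j → δ (offset i j) 0 ≡ Id m i j
  δ-offset-0 i j = trans (δ-offset i j (s≤s z≤n)) (cong (λ x → Id m x j) (⊞-identityʳ i))

  module _ (c : ℕ → K) (v : K)
    (recurrence : ∀ k → k < m →
      ofℕ 3 *K c k -K c ((k + m′) % m) -K c ((k + 1) % m) ≡ 1K -K v *K δ k 0)
    where

    stencil-⊗-circ : stencil ⊗ circ m c ≈M Jm m ⊖ v ·M Id m
    stencil-⊗-circ i j = begin
      (stencil ⊗ circ m c) i j
        ≡⟨ stencil-⊗ (circ m c) i j ⟩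
      ofℕ 3 *K c (offset i j) -K c (offset (i ⊞ 1) j) -K c (offset (i ⊞ m′) j)
        ≡⟨ cong₂ (λ x y → ofℕ 3 *K c (offset i j) -K c x -K c y)
             (offset-⊞ˡ i j refl) (offset-⊞ˡ i j (+-comm m′ 1)) ⟩
      ofℕ 3 *K c (offset i j) -K c ((offset i j + m′) % m) -K c ((offset i j + 1) % m)
        ≡⟨ recurrence (offset i j) (offset< i j) ⟩
      1K -K v *K δ (offset i j) 0
        ≡⟨ cong (λ x → 1K -K v *K x) (δ-offset-0 i j) ⟩
      1K -K v *K Id m i j ∎

    circ-⊗-stencil : circ m c ⊗ stencil ≈M Jm m ⊖ v ·M Id m
    circ-⊗-stencil i j = begin
      (circ m c ⊗ stencil) i j
        ≡⟨ ⊗-stencil (circ m c) i j ⟩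
      ofℕ 3 *K c (offset i j) -K c (offset i (j ⊞ m′)) -K c (offset i (j ⊞ 1))
        ≡⟨ cong₂ (λ x y → ofℕ 3 *K c (offset i j) -K c x -K c y) (offset-⊞ʳ i j m′) (offset-⊞ʳ i j 1) ⟩
      ofℕ 3 *K c (offset i j) -K c ((offset i j + m′) % m) -K c ((offset i j + 1) % m)
        ≡⟨ recurrence (offset i j) (offset< i j) ⟩
      1K -K v *K δ (offset i j) 0
        ≡⟨ cong (λ x → 1K -K v *K x) (δ-offset-0 i j) ⟩
      1K -K v *K Id m i j ∎

  stencil-⊗-Jm : stencil ⊗ Jm m ≈M Jm m
  stencil-⊗-Jm i j = trans (stencil-⊗ (Jm m) i j) refl

  Jm-⊗-stencil : Jm m ⊗ stencil ≈M Jm m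
  Jm-⊗-stencil i j = trans (⊗-stencil (Jm m) i j) refl

module WheelCirculants (q : ℕ) where

  m′ : ℕ
  m′ = suc (suc q)

  open Cyclic m′ public
  open import Data.Nat.Properties using (n<1+n; +-comm)

  -- m ≥ 3 keeps the offsets 0, 1 and m - 1 distinct
  Bcoef-δ : ∀ k → Bcoef m k ≡ ofℕ 3 *K δ k 0 -K δ k 1 -K δ k m′
  Bcoef-δ zero = refl
  Bcoef-δ (suc zero) = refl
  Bcoef-δ (suc (suc k)) with suc (suc k) ℕ.≟ m′
  ... | yes _ = refl
  ... | no  _ = refl

  Ccoef-δ : ∀ k → Ccoef m k ≡ δ k 0 -K δ k m′
  Ccoef-δ zero = refl
  Ccoef-δ (suc k) with suc k ℕ.≟ m′
  ... | yes _ = refl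
  ... | no  _ = refl

  Bm≈stencil : Bm m ≈M stencil
  Bm≈stencil i j = begin
    Bcoef m (offset i j)
      ≡⟨ Bcoef-δ (offset i j) ⟩
    ofℕ 3 *K δ (offset i j) 0 -K δ (offset i j) 1 -K δ (offset i j) m′
      ≡⟨ cong₂ (λ x y → ofℕ 3 *K x -K y -K δ (offset i j) m′) (δ-offset-0 i j) (δ-offset i j (s≤s (s≤s z≤n))) ⟩
    ofℕ 3 *K Id m i j -K S 1 i j -K δ (offset i j) m′
      ≡⟨ cong (_-K_ (ofℕ 3 *K Id m i j -K S 1 i j)) (δ-offset i j (n<1+n m′)) ⟩
    ofℕ 3 *K Id m i j -K S 1 i j -K S m′ i j ∎
    where open ≡-Reasoning

  Cm≈ : Cm m ≈M Id m ⊖ S m′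
  Cm≈ i j = trans (Ccoef-δ (offset i j)) (cong₂ _-K_ (δ-offset-0 i j) (δ-offset i j (n<1+n m′)))

  Cmᵀ≈ : Cm m ᵀ ≈M Id m ⊖ S 1
  Cmᵀ≈ i j = trans (Cm≈ j i) (cong₂ _-K_ (Id-sym m j i) (S-transpose (+-comm m′ 1) i j))

  CCᵀ⊕I≈stencil : (Cm m ⊗ Cm m ᵀ) ⊕ Id m ≈M stencil
  CCᵀ⊕I≈stencil i j = begin
    (Cm m ⊗ Cm m ᵀ) i j +K Id m i j
      ≡⟨ cong (_+K Id m i j) (⊗-cong Cm≈ Cmᵀ≈ i j) ⟩
    ((Id m ⊖ S m′) ⊗ (Id m ⊖ S 1)) i j +K Id m i j
      ≡⟨ cong (_+K Id m i j) (⊗-distribʳ-⊖ (Id m) (S m′) (Id m ⊖ S 1) i j) ⟩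
    ((Id m ⊗ (Id m ⊖ S 1)) i j -K (S m′ ⊗ (Id m ⊖ S 1)) i j) +K Id m i j
      ≡⟨ cong₂ (λ x y → (x -K y) +K Id m i j) (⊗-identityˡ (Id m ⊖ S 1) i j) (S-⊗ m′ (Id m ⊖ S 1) i j) ⟩
    ((Id m i j -K S 1 i j) -K (S m′ i j -K Id m (i ⊞ m′ ⊞ 1) j)) +K Id m i j
      ≡⟨ cong (λ x → ((Id m i j -K S 1 i j) -K (S m′ i j -K Id m x j)) +K Id m i j)
           (⊞-cancel i (+-comm m′ 1)) ⟩
    ((Id m i j -K S 1 i j) -K (S m′ i j -K Id m i j)) +K Id m i j
      ≡⟨ collect (Id m i j) (S 1 i j) (S m′ i j) ⟩
    ofℕ 3 *K Id m i j -K S 1 i j -K S m′ i j ∎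
    where
    open ≡-Reasoning
    collect : ∀ x y z → ((x -K y) -K (z -K x)) +K x ≡ ofℕ 3 *K x -K y -K z
    collect = solve-∀ K-solverRing

-- The denominators of b_j

two φ₊ φ₋ : K
two = ofℕ 2
φ₊ = ofℕ 3 +K √5
φ₋ = ofℕ 3 -K √5

norm-^K-≡ : ∀ {x y} → norm x ≡ norm y → ∀ m → norm (x ^K m) ≡ norm (y ^K m)
norm-^K-≡ Nx≡Ny zero = refl
norm-^K-≡ {x} {y} Nx≡Ny (suc m) = begin
  norm (x *K x ^K m)         ≡⟨ norm-*K x (x ^K m) ⟩
  norm x Q.* norm (x ^K m)   ≡⟨ cong₂ Q._*_ Nx≡Ny (norm-^K-≡ Nx≡Ny m) ⟩
  norm y Q.* norm (y ^K m)   ≡⟨ norm-*K y (y ^K m) ⟨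
  norm (y *K y ^K m)         ∎
  where open ≡-Reasoning

conj-^K : ∀ x m → conj (x ^K m) ≡ conj x ^K m
conj-^K x zero = refl
conj-^K x (suc m) = trans (conj-*K x (x ^K m)) (cong (conj x *K_) (conj-^K x m))

im-two^ : ∀ m → im (two ^K m) ≡ 0ℚ
im-two^ zero = refl
im-two^ (suc m) = begin
  re two Q.* im (two ^K m) Q.+ 0ℚ Q.* re (two ^K m)
    ≡⟨ cong₂ (λ s t → re two Q.* s Q.+ t) (im-two^ m) (ℚP.*-zeroˡ (re (two ^K m))) ⟩
  re two Q.* 0ℚ Q.+ 0ℚ
    ≡⟨⟩
  0ℚ ∎
  where open ≡-Reasoning

re-two^-suc : ∀ m → re (two ^K suc m) ≡ re two Q.* re (two ^K m)
re-two^-suc m = begin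
  re two Q.* re (two ^K m) Q.+ five Q.* (0ℚ Q.* im (two ^K m))
    ≡⟨ cong (λ t → re two Q.* re (two ^K m) Q.+ five Q.* t) (ℚP.*-zeroˡ (im (two ^K m))) ⟩
  re two Q.* re (two ^K m) Q.+ five Q.* 0ℚ
    ≡⟨ cong (re two Q.* re (two ^K m) Q.+_) (ℚP.*-zeroʳ five) ⟩
  re two Q.* re (two ^K m) Q.+ 0ℚ
    ≡⟨ ℚP.+-identityʳ _ ⟩
  re two Q.* re (two ^K m) ∎
  where open ≡-Reasoning

record φ₊^-Dominates (m : ℕ) : Set where
  field
    two^-pos  : Positive (re (two ^K m))
    gap-pos   : Positive (re (φ₊ ^K m) Q.- re (two ^K m))
    im-nonNeg : NonNegative (im (φ₊ ^K m))

φ₊^-dominates : ∀ m → φ₊^-Dominates (suc m)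
φ₊^-dominates zero = record { two^-pos = _ ; gap-pos = _ ; im-nonNeg = _ }
φ₊^-dominates (suc m) = record
  { two^-pos  = subst Positive (sym (re-two^-suc (suc m))) (ℚP.pos*pos⇒pos (re two) c {{two^-pos}})
  ; gap-pos   = subst Positive (sym new-gap)
                  (ℚP.pos+nonNeg⇒pos (re φ₊ Q.* (a Q.- c)) {{ℚP.pos*pos⇒pos (re φ₊) (a Q.- c) {{gap-pos}}}}
                     (c Q.+ five Q.* (im φ₊ Q.* b)) {{c+5b≥0}})
  ; im-nonNeg = ℚP.nonNeg+nonNeg⇒nonNeg (re φ₊ Q.* b) {{ℚP.nonNeg*nonNeg⇒nonNeg (re φ₊) b {{im-nonNeg}}}}
                                        (im φ₊ Q.* a) {{ℚP.nonNeg*nonNeg⇒nonNeg (im φ₊) a {{a≥0}}}}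
  }
  where
  open φ₊^-Dominates (φ₊^-dominates m)
  open Q using (_+_; _*_; _-_)
  a = re (φ₊ ^K suc m)
  b = im (φ₊ ^K suc m)
  c = re (two ^K suc m)
  a≥0 : NonNegative a
  a≥0 = subst NonNegative (sub-add a c)
          (ℚP.pos⇒nonNeg ((a - c) + c) {{ℚP.pos+pos⇒pos (a - c) {{gap-pos}} c {{two^-pos}}}})
    where
    sub-add : ∀ a c → (a - c) + c ≡ a
    sub-add = solve-∀ ℚ-solverRing
  c+5b≥0 : NonNegative (c + five * (im φ₊ * b))
  c+5b≥0 = ℚP.nonNeg+nonNeg⇒nonNeg c {{ℚP.pos⇒nonNeg c {{two^-pos}}}} (five * (im φ₊ * b))
             {{ℚP.nonNeg*nonNeg⇒nonNeg five (im φ₊ * b) {{ℚP.nonNeg*nonNeg⇒nonNeg (im φ₊) b {{im-nonNeg}}}}}}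
  new-gap : (re φ₊ * a + five * (im φ₊ * b)) - re (two ^K suc (suc m))
            ≡ re φ₊ * (a - c) + (c + five * (im φ₊ * b))
  new-gap = trans (cong ((re φ₊ * a + five * (im φ₊ * b)) -_) (re-two^-suc (suc m)))
                  (regroup a b c (im φ₊) five)
    where
    regroup : ∀ a b c s f → (re φ₊ * a + f * (s * b)) - re two * c ≡ re φ₊ * (a - c) + (c + f * (s * b))
    regroup = solve-∀ ℚ-solverRing

invK-two^-φ₊^ : ∀ m → invK (two ^K suc m -K φ₊ ^K suc m) *K (two ^K suc m -K φ₊ ^K suc m) ≡ 1K
invK-two^-φ₊^ m = invK-sub-inverseˡ (two ^K suc m) (φ₊ ^K suc m) (im-two^ (suc m))
                    (norm-^K-≡ {φ₊} {two} refl (suc m)) two^-pos gap-pos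
  where open φ₊^-Dominates (φ₊^-dominates m)

invK-two^-φ₋^ : ∀ m → invK (two ^K suc m -K φ₋ ^K suc m) *K (two ^K suc m -K φ₋ ^K suc m) ≡ 1K
invK-two^-φ₋^ m = subst (λ y → invK (two ^K suc m -K y) *K (two ^K suc m -K y) ≡ 1K)
  (conj-^K φ₊ (suc m))
  (invK-sub-inverseˡ (two ^K suc m) (conj (φ₊ ^K suc m)) (im-two^ (suc m))
     (trans (norm-conj (φ₊ ^K suc m)) (norm-^K-≡ {φ₊} {two} refl (suc m))) two^-pos gap-pos)
  where open φ₊^-Dominates (φ₊^-dominates m)

-- The recurrence of the coefficients b_j

module CoefficientRecurrence (n u v : K) where

  w : K
  w = invK √5

  -- b_j with 2^{m-j}, (3+√5)^j and (3-√5)^j abstracted to e, p₊ and p₋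
  β : K → K → K → K
  β e p₊ p₋ = 1K +K ((n *K e) *K w) *K (p₊ *K u -K p₋ *K v)

  -- (3 ± √5)/2 are the roots of t² - 3t + 1
  β-interior : ∀ E p₊ p₋ →
    ofℕ 3 *K β (two *K E) (φ₊ *K p₊) (φ₋ *K p₋) -K β (two *K (two *K E)) p₊ p₋
      -K β E (φ₊ *K (φ₊ *K p₊)) (φ₋ *K (φ₋ *K p₋)) ≡ 1K
  β-interior = identity n u v
    where
    identity : ∀ n u v E p₊ p₋ →
      ofℕ 3 *K (1K +K ((n *K (two *K E)) *K w) *K ((φ₊ *K p₊) *K u -K (φ₋ *K p₋) *K v))
        -K (1K +K ((n *K (two *K (two *K E))) *K w) *K (p₊ *K u -K p₋ *K v))
        -K (1K +K ((n *K E) *K w) *K ((φ₊ *K (φ₊ *K p₊)) *K u -K (φ₋ *K (φ₋ *K p₋)) *K v)) ≡ 1K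
    identity = solve-∀ K-solverRing

  substitute-units : ∀ {x y} c₁ A₁ c₂ A₂ → x ≡ y +K c₁ *K (A₁ -K 1K) +K c₂ *K (A₂ -K 1K) →
                     A₁ ≡ 1K → A₂ ≡ 1K → x ≡ y
  substitute-units {x} {y} c₁ A₁ c₂ A₂ x≡ refl refl = trans x≡ (vanish y c₁ c₂)
    where
    vanish : ∀ y c₁ c₂ → y +K c₁ *K (1K -K 1K) +K c₂ *K (1K -K 1K) ≡ y
    vanish = solve-∀ K-solverRing

  -- At the two wrap-around indices the defect is a combination of u (2^m - φ₊^m) - 1 and
  -- v (2^m - φ₋^m) - 1, which vanish by the choice of u and v.
  β-first : ∀ E p₊ p₋ → u *K (two *K E -K φ₊ *K p₊) ≡ 1K → v *K (two *K E -K φ₋ *K p₋) ≡ 1K →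
    ofℕ 3 *K β (two *K E) 1K 1K -K β (two *K 1K) p₊ p₋ -K β E (φ₊ *K 1K) (φ₋ *K 1K) ≡ 1K -K n
  β-first E p₊ p₋ uD₊≡1 vD₋≡1 = substitute-units
    (n *K w *K (φ₋ *K invK two)) (u *K (two *K E -K φ₊ *K p₊))
    (-K (n *K w *K (φ₊ *K invK two))) (v *K (two *K E -K φ₋ *K p₋))
    (defect n u v E p₊ p₋) uD₊≡1 vD₋≡1
    where
    defect : ∀ n u v E p₊ p₋ →
      ofℕ 3 *K (1K +K ((n *K (two *K E)) *K w) *K (1K *K u -K 1K *K v))
        -K (1K +K ((n *K (two *K 1K)) *K w) *K (p₊ *K u -K p₋ *K v))
        -K (1K +K ((n *K E) *K w) *K ((φ₊ *K 1K) *K u -K (φ₋ *K 1K) *K v))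
      ≡ (1K -K n) +K (n *K w *K (φ₋ *K invK two)) *K (u *K (two *K E -K φ₊ *K p₊) -K 1K)
        +K (-K (n *K w *K (φ₊ *K invK two))) *K (v *K (two *K E -K φ₋ *K p₋) -K 1K)
    defect = solve-∀ K-solverRing

  β-last : ∀ E p₊ p₋ → u *K (two *K (two *K E) -K φ₊ *K (φ₊ *K p₊)) ≡ 1K →
    v *K (two *K (two *K E) -K φ₋ *K (φ₋ *K p₋)) ≡ 1K →
    ofℕ 3 *K β (two *K 1K) (φ₊ *K p₊) (φ₋ *K p₋) -K β (two *K (two *K 1K)) p₊ p₋
      -K β (two *K (two *K E)) 1K 1K ≡ 1K
  β-last E p₊ p₋ uD₊≡1 vD₋≡1 = substitute-units
    (-K (n *K w)) (u *K (two *K (two *K E) -K φ₊ *K (φ₊ *K p₊)))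
    (n *K w) (v *K (two *K (two *K E) -K φ₋ *K (φ₋ *K p₋)))
    (defect n u v E p₊ p₋) uD₊≡1 vD₋≡1
    where
    defect : ∀ n u v E p₊ p₋ →
      ofℕ 3 *K (1K +K ((n *K (two *K 1K)) *K w) *K ((φ₊ *K p₊) *K u -K (φ₋ *K p₋) *K v))
        -K (1K +K ((n *K (two *K (two *K 1K))) *K w) *K (p₊ *K u -K p₋ *K v))
        -K (1K +K ((n *K (two *K (two *K E))) *K w) *K (1K *K u -K 1K *K v))
      ≡ 1K +K (-K (n *K w)) *K (u *K (two *K (two *K E) -K φ₊ *K (φ₊ *K p₊)) -K 1K)
        +K (n *K w) *K (v *K (two *K (two *K E) -K φ₋ *K (φ₋ *K p₋)) -K 1K)
    defect = solve-∀ K-solverRing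

module Coefficients (q : ℕ) where

  open import Data.Nat using (_+_; _∸_; _%_)
  open import Data.Nat.Properties
    using (+-comm; +-suc; m+n∸n≡m; +-∸-assoc; <⇒≤; ≤-trans; n≤1+n; n<1+n; ≤∧≢⇒<)
  open import Data.Nat.DivMod using (m<n⇒m%n≡m; [m+n]%n≡m%n; n%n≡0)

  p m′ m : ℕ
  p  = suc q
  m′ = suc p
  m  = suc m′

  n u v : K
  n = ofℕ (suc m)
  u = invK (two ^K m -K φ₊ ^K m)
  v = invK (two ^K m -K φ₋ ^K m)

  open CoefficientRecurrence n u v

  b : ℕ → K
  b = bcoef m

  b≡β : ∀ j {e} → two ^K (m ∸ j) ≡ e → b j ≡ β e (φ₊ ^K j) (φ₋ ^K j)
  b≡β j 2^≡e = cong (λ e → β e (φ₊ ^K j) (φ₋ ^K j)) 2^≡e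

  uD₊≡1 : u *K (two ^K m -K φ₊ ^K m) ≡ 1K
  uD₊≡1 = invK-two^-φ₊^ m′

  vD₋≡1 : v *K (two ^K m -K φ₋ ^K m) ≡ 1K
  vD₋≡1 = invK-two^-φ₋^ m′

  Recurrence : ℕ → Set
  Recurrence k = ofℕ 3 *K b k -K b ((k + m′) % m) -K b ((k + 1) % m) ≡ 1K -K n *K δ k 0

  1≡1-n·0 : 1K ≡ 1K -K n *K 0K
  1≡1-n·0 = annihilate n
    where
    annihilate : ∀ n → 1K ≡ 1K -K n *K 0K
    annihilate = solve-∀ K-solverRing

  recurrence-first : Recurrence 0
  recurrence-first = begin
    ofℕ 3 *K b 0 -K b (m′ % m) -K b (1 % m)
      ≡⟨ cong₂ (λ x y → ofℕ 3 *K b 0 -K b x -K b y) (m<n⇒m%n≡m {n = m} (n<1+n m′)) (m<n⇒m%n≡m {n = m} (s≤s (s≤s z≤n))) ⟩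
    ofℕ 3 *K b 0 -K b m′ -K b 1
      ≡⟨ cong (λ x → ofℕ 3 *K b 0 -K x -K b 1) (b≡β m′ (cong (two ^K_) (m+n∸n≡m 1 m′))) ⟩
    ofℕ 3 *K b 0 -K β (two *K 1K) (φ₊ ^K m′) (φ₋ ^K m′) -K b 1
      ≡⟨ β-first (two ^K m′) (φ₊ ^K m′) (φ₋ ^K m′) uD₊≡1 vD₋≡1 ⟩
    1K -K n
      ≡⟨ cong (_-K_ 1K) (*K-identityʳ n) ⟨
    1K -K n *K 1K ∎
    where open ≡-Reasoning

  recurrence-last : Recurrence m′
  recurrence-last = begin
    ofℕ 3 *K b m′ -K b ((m′ + m′) % m) -K b ((m′ + 1) % m)
      ≡⟨ cong₂ (λ x y → ofℕ 3 *K b m′ -K b x -K b y) m′+m′≡p m′+1≡0 ⟩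
    ofℕ 3 *K b m′ -K b p -K b 0
      ≡⟨ cong₂ (λ x y → ofℕ 3 *K x -K y -K b 0)
           (b≡β m′ (cong (two ^K_) (m+n∸n≡m 1 m′))) (b≡β p (cong (two ^K_) (m+n∸n≡m 2 p))) ⟩
    ofℕ 3 *K β (two *K 1K) (φ₊ ^K m′) (φ₋ ^K m′) -K β (two *K (two *K 1K)) (φ₊ ^K p) (φ₋ ^K p) -K b 0
      ≡⟨ β-last (two ^K p) (φ₊ ^K p) (φ₋ ^K p) uD₊≡1 vD₋≡1 ⟩
    1K
      ≡⟨ 1≡1-n·0 ⟩
    1K -K n *K 0K ∎
    where
    open ≡-Reasoning
    m′+m′≡p : (m′ + m′) % m ≡ p
    m′+m′≡p = trans (cong (_% m) (trans (cong suc (+-suc p p)) (+-comm (suc (suc p)) p)))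
                    (trans ([m+n]%n≡m%n p m) (m<n⇒m%n≡m {n = m} (≤-trans (n<1+n p) (n≤1+n m′))))
    m′+1≡0 : (m′ + 1) % m ≡ 0
    m′+1≡0 = trans (cong (_% m) (+-comm m′ 1)) (n%n≡0 m)

  recurrence-interior : ∀ a → suc a < m′ → Recurrence (suc a)
  recurrence-interior a 1+a<m′ = begin
    ofℕ 3 *K b (suc a) -K b ((suc a + m′) % m) -K b ((suc a + 1) % m)
      ≡⟨ cong₂ (λ x y → ofℕ 3 *K b (suc a) -K b x -K b y) 1+a+m′≡a 1+a+1≡2+a ⟩
    ofℕ 3 *K b (suc a) -K b a -K b (suc (suc a))
      ≡⟨ cong₂ (λ x y → ofℕ 3 *K x -K y -K b (suc (suc a)))
           (b≡β (suc a) (cong (two ^K_) m′∸a≡suc)) (b≡β a (cong (two ^K_) m∸a≡suc²)) ⟩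
    ofℕ 3 *K β (two *K E) (φ₊ ^K suc a) (φ₋ ^K suc a) -K β (two *K (two *K E)) (φ₊ ^K a) (φ₋ ^K a)
      -K b (suc (suc a))
      ≡⟨ β-interior E (φ₊ ^K a) (φ₋ ^K a) ⟩
    1K
      ≡⟨ 1≡1-n·0 ⟩
    1K -K n *K 0K ∎
    where
    open ≡-Reasoning
    E : K
    E = two ^K (m′ ∸ suc a)
    a<m′ : a < m′
    a<m′ = ≤-trans (n≤1+n (suc a)) 1+a<m′
    m′∸a≡suc : m′ ∸ a ≡ suc (m′ ∸ suc a)
    m′∸a≡suc = +-∸-assoc 1 (<⇒≤ 1+a<m′)
    m∸a≡suc² : m ∸ a ≡ suc (suc (m′ ∸ suc a))
    m∸a≡suc² = trans (+-∸-assoc 1 (<⇒≤ a<m′)) (cong suc m′∸a≡suc)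
    1+a+m′≡a : (suc a + m′) % m ≡ a
    1+a+m′≡a = trans (cong (_% m) (sym (+-suc a m′)))
                     (trans ([m+n]%n≡m%n a m) (m<n⇒m%n≡m {n = m} (≤-trans a<m′ (n≤1+n m′))))
    1+a+1≡2+a : (suc a + 1) % m ≡ suc (suc a)
    1+a+1≡2+a = trans (cong (_% m) (+-comm (suc a) 1)) (m<n⇒m%n≡m {n = m} (s≤s 1+a<m′))

  recurrence : ∀ k → k < m → Recurrence k
  recurrence zero    _            = recurrence-first
  recurrence (suc a) (s≤s a<m′) = recurrence-suc (suc a ℕ.≟ m′)
    where
    -- matching on the decision directly: a with-abstraction would normalise the goal
    recurrence-suc : Dec (suc a ≡ m′) → Recurrence (suc a)
    recurrence-suc (yes 1+a≡m′) = subst Recurrence (sym 1+a≡m′) recurrence-last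
    recurrence-suc (no  1+a≢m′) = recurrence-interior a (≤∧≢⇒< a<m′ 1+a≢m′)

module Wheel (q : ℕ) where

  open WheelCirculants q
  open Coefficients q using (recurrence)

  n : K
  n = ofℕ (suc m)

  Bm⊗Xm : Bm m ⊗ Xm m ≈M Jm m ⊖ n ·M Id m
  Bm⊗Xm = ≈M-trans (⊗-congʳ (Xm m) Bm≈stencil) (stencil-⊗-circ (bcoef m) n recurrence)

  Xm⊗Bm : Xm m ⊗ Bm m ≈M Jm m ⊖ n ·M Id m
  Xm⊗Bm = ≈M-trans (⊗-congˡ (Xm m) Bm≈stencil) (circ-⊗-stencil (bcoef m) n recurrence)

  Bm⊗Jm : Bm m ⊗ Jm m ≈M Jm m
  Bm⊗Jm = ≈M-trans (⊗-congʳ (Jm m) Bm≈stencil) stencil-⊗-Jm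

  Jm⊗Bm : Jm m ⊗ Bm m ≈M Jm m
  Jm⊗Bm = ≈M-trans (⊗-congˡ (Jm m) Bm≈stencil) Jm-⊗-stencil

  CCᵀ⊕I≈Bm : (Cm m ⊗ Cm m ᵀ) ⊕ Id m ≈M Bm m
  CCᵀ⊕I≈Bm = ≈M-trans CCᵀ⊕I≈stencil (≈M-sym Bm≈stencil)

  open BorderedInverse m (Bm m) (Xm m) Bm⊗Jm Jm⊗Bm Bm⊗Xm Xm⊗Bm public
    using (isMoorePenroseInverse; Minv; isInverse; MinvJ-nI≈X)

mainTheorem10 : (m : ℕ) → 3 ≤ m →
    let n = suc m
        M = (Cm m ⊗ Cm m ᵀ) ⊕ Id m
    in IsMoorePenroseInverse (Lw m) (Lplus m)
       × Σ (Mat m) (λ Minv → IsInverse M Minv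
                      × (Minv ⊗ (Jm m ⊖ ofℕ n ·M Id m) ≈M Xm m))
mainTheorem10 (suc (suc (suc q))) (s≤s (s≤s (s≤s z≤n))) =
  isMoorePenroseInverse , Minv , isInverse CCᵀ⊕I≈Bm , MinvJ-nI≈X
  where open Wheel q
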